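{- Let $p$ be the mesh pattern $(12,R)$ with $R=\{(0,0),(0,1),(0,2),(1,0),(1,2),(2,0),(2,1)\}$, let $E(t,u)=\sum_{n\ge0}t^n\sum_{\sigma\in K_n}u^{p(\sigma)}$, and let $P(t)=\sum_{n\ge0}|K_n(p)|t^n$. Then $$P(t)=\left(\frac{1}{1+t}+\frac{t(1+t)}{1+t+tA(t)}\right)A(t),\qquad E(t,u)=\left(\frac{1}{1+t}+\frac{t(1+t)}{1+t\big(1+u+ut+(1-u)A(t)\big)}\right)A(t).$$ The initial terms of $E(t,u)$ are $1+t+2t^4+14t^5+(88+2u)t^6+(636+10u)t^7+(5174+68u)t^8+\cdots$.
   Context: A permutation $\sigma=\sigma_1\cdots\sigma_n$ of $\{1,\dots,n\}$ is a king permutation if $|\sigma_{i+1}-\sigma_i|>1$ for all $1\le i\le n-1$. $K_n$ is the set of king permutations of length $n$ ($K_0$ = the empty permutation, $K_1=\{1\}$) and $A(t)=\sum_{n\ge0}|K_n|t^n$ (known to equal $\sum_{n\ge0}n!\,t^n(1-t)^n/(1+t)^n$). For a mesh pattern $p=(12,R)$ with $R\subseteq\{0,1,2\}^2$, an occurrence of $p$ in $\sigma\in S_n$ is a pair of positions $i_1<i_2$ with $\sigma_{i_1}<\sigma_{i_2}$ such that for every $(x,y)\in R$ there is no position $m$ with $i_x<m<i_{x+1}$ and $v_y<\sigma_m<v_{y+1}$, where $i_0=0$, $i_3=n+1$, $v_0=0$, $v_1=\sigma_{i_1}$, $v_2=\sigma_{i_2}$, $v_3=n+1$ (first coordinate of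 a box indexes positions, second values). $p(\sigma)$ is the number of occurrences of $p$ in $\sigma$; $K_n(p)$ is the set of king $n$-permutations with $p(\sigma)=0$. -}

module Defs where

open import Data.Nat using (ℕ; zero; suc; _∸_; _<ᵇ_; _≡ᵇ_; ∣_-_∣)
open import Data.Bool using (Bool; true; false; _∧_; _∨_; not; if_then_else_)
open import Data.List using (List; []; _∷_; map; concatMap; filter; length; upTo)
open import Data.Bool.ListAction using (all; any)
open import Data.Product using (_×_; _,_)
open import Data.Integer using (ℤ; +_; _+_; _*_; -_)
open import Relation.Nullary.Decidable using (Dec)
open import Data.Bool.Properties using (T?)

-- Permutations of {1,…,n}, represented in one-line notation as lists
-- σ₁ ∷ … ∷ σₙ ∷ [].

insertAll : ℕ → List ℕ → List (List ℕ)
insertAll x [] = (x ∷ []) ∷ []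
insertAll x (y ∷ ys) = (x ∷ y ∷ ys) ∷ map (y ∷_) (insertAll x ys)

perms : ℕ → List (List ℕ)
perms zero = [] ∷ []
perms (suc n) = concatMap (insertAll (suc n)) (perms n)

-- σ_i for 1-based position i (0 outside the range 1..n; never used there).
at : List ℕ → ℕ → ℕ
at [] _ = 0
at (x ∷ xs) zero = 0
at (x ∷ xs) (suc zero) = x
at (x ∷ xs) (suc (suc i)) = at xs (suc i)

isKing : List ℕ → Bool
isKing [] = true
isKing (x ∷ []) = true
isKing (x ∷ y ∷ ys) = (1 <ᵇ ∣ x - y ∣) ∧ isKing (y ∷ ys)

-- Mesh patterns (12, R).  A box (x , y) with x, y ∈ {0,1,2}.

Box : Set
Box = ℕ × ℕ

sel3 : ℕ → ℕ → ℕ → ℕ → ℕ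
sel3 a b c zero = a
sel3 a b c (suc zero) = b
sel3 a b c (suc (suc _)) = c

positions : ℕ → List ℕ
positions n = map suc (upTo n)

-- box (x,y) is empty for the occurrence at positions i₁ < i₂ of σ ∈ S_n:
-- no position m with i_x < m < i_{x+1} and v_y < σ_m < v_{y+1},
-- where i₀ = 0, i₃ = n+1, v₀ = 0, v₁ = σ_{i₁}, v₂ = σ_{i₂}, v₃ = n+1.
boxEmpty : List ℕ → ℕ → ℕ → Box → Bool
boxEmpty σ i₁ i₂ (x , y) =
  let n = length σ
      v₁ = at σ i₁
      v₂ = at σ i₂
      pl = sel3 0 i₁ i₂ x
      ph = sel3 i₁ i₂ (suc n) x
      vl = sel3 0 v₁ v₂ y
      vh = sel3 v₁ v₂ (suc n) y
  in not (any (λ m → (pl <ᵇ m) ∧ (m <ᵇ ph) ∧ (vl <ᵇ at σ m) ∧ (at σ m <ᵇ vh))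
              (positions n))

isOcc : List Box → List ℕ → ℕ → ℕ → Bool
isOcc R σ i₁ i₂ =
  (i₁ <ᵇ i₂) ∧ (at σ i₁ <ᵇ at σ i₂) ∧ all (boxEmpty σ i₁ i₂) R

occurrences : List Box → List ℕ → ℕ
occurrences R σ =
  let ps = positions (length σ) in
  length (concatMap (λ i₁ → filter (λ i₂ → T? (isOcc R σ i₁ i₂)) ps) ps)

R₀ : List Box
R₀ = (0 , 0) ∷ (0 , 1) ∷ (0 , 2) ∷ (1 , 0) ∷ (1 , 2) ∷ (2 , 0) ∷ (2 , 1) ∷ []

-- Formal power series in t with coefficients in ℤ[u], represented by
-- their coefficient array:  F n k = [t^n u^k] F.

Series : Set
Series = ℕ → ℕ → ℤ

sumTo : ℕ → (ℕ → ℤ) → ℤ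
sumTo zero f = f 0
sumTo (suc n) f = sumTo n f + f (suc n)

_⊕_ : Series → Series → Series
(f ⊕ g) n k = f n k + g n k

_⊖_ : Series → Series → Series
(f ⊖ g) n k = f n k + - g n k

_⊗_ : Series → Series → Series
(f ⊗ g) n k = sumTo n (λ i → sumTo k (λ j → f i j * g (n ∸ i) (k ∸ j)))

infixl 6 _⊕_ _⊖_
infixl 7 _⊗_

𝟙 : Series
𝟙 zero zero = + 1
𝟙 _ _ = + 0

𝕥 : Series
𝕥 (suc zero) zero = + 1
𝕥 _ _ = + 0

𝕦 : Series
𝕦 zero (suc zero) = + 1
𝕦 _ _ = + 0

count : (List ℕ → Bool) → List (List ℕ) → ℕ
count P xs = length (filter (λ x → T? (P x)) xs)

A : Series
A n zero = + count isKing (perms n)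
A n (suc _) = + 0

E : Series
E n k = + count (λ σ → isKing σ ∧ (occurrences R₀ σ ≡ᵇ k)) (perms n)

P : Series
P n zero = + count (λ σ → isKing σ ∧ (occurrences R₀ σ ≡ᵇ 0)) (perms n)
P n (suc _) = + 0

-- Denominators (each has constant term 1, hence is a unit):
-- D₀ = 1 + t + t A(t),   D = 1 + t(1 + u + ut + (1-u) A(t)).
D₀ : Series
D₀ = 𝟙 ⊕ 𝕥 ⊕ 𝕥 ⊗ A

D : Series
D = 𝟙 ⊕ 𝕥 ⊗ (𝟙 ⊕ 𝕦 ⊕ 𝕦 ⊗ 𝕥 ⊕ (𝟙 ⊖ 𝕦) ⊗ A)

initialE : Series
initialE 0 0 = + 1
initialE 1 0 = + 1
initialE 4 0 = + 2
initialE 5 0 = + 14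
initialE 6 0 = + 88
initialE 6 1 = + 2
initialE 7 0 = + 636
initialE 7 1 = + 10
initialE 8 0 = + 5174
initialE 8 1 = + 68
initialE _ _ = + 0

-- Column 0 and row 0 of p are shaded, so an occurrence must start at position 1 with
-- value 1: only permutations 1 ⊕ τ have occurrences, and those of 1 ⊕ τ correspond to
-- the separators of τ, the entries exceeding everything to their left and smaller than
-- everything to their right. Moreover 1 ⊕ τ is a king iff τ is a king not starting
-- with 1. With B and H the generating functions of such τ (H marking separators by u),
-- this gives A = (1 + t) B, E = B + t H and P = B + t H(t, 0). Cutting τ at its first
-- separator writes it uniquely as α ⊕ (1 ⊕ β), where α is a nonempty separator-free
-- king (counted by X) and β is again a king not starting with 1; hence
-- B = 1 + X + X t B and H = 1 + X + u X t H. Eliminating X, which only requires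
-- 1 - X t to be cancellable, yields both formulas.

module Submission where

open import Algebra.Bundles using (CommutativeRing)

module FormalPowerSeries {c ℓ} (R : CommutativeRing c ℓ) where

  open CommutativeRing R
  open import Algebra.Structures using (IsCommutativeRing)
  open import Data.Nat using (ℕ; zero; suc; _∸_; _≤_; z≤n)
  open import Data.Nat.Properties using (m∸[m∸n]≡n; ≤-refl; m≤n⇒m≤1+n)
  open import Data.Product using (_,_)
  open import Relation.Binary.Reasoning.Setoid setoid
  import Relation.Binary.PropositionalEquality as ≡

  PowerSeries : Set c
  PowerSeries = ℕ → Carrier

  infix 4 _≋_
  infixl 6 _⊞_
  infixl 7 _⊠_

  _≋_ : PowerSeries → PowerSeries → Set ℓ
  f ≋ g = ∀ n → f n ≈ g n

  Σ≤ : ℕ → (ℕ → Carrier) → Carrier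
  Σ≤ zero f = f 0
  Σ≤ (suc n) f = Σ≤ n f + f (suc n)

  _⊞_ : PowerSeries → PowerSeries → PowerSeries
  (f ⊞ g) n = f n + g n

  _⊠_ : PowerSeries → PowerSeries → PowerSeries
  (f ⊠ g) n = Σ≤ n (λ i → f i * g (n ∸ i))

  ⊟_ : PowerSeries → PowerSeries
  (⊟ f) n = - f n

  𝟘 : PowerSeries
  𝟘 _ = 0#

  𝟏 : PowerSeries
  𝟏 zero = 1#
  𝟏 (suc _) = 0#

  Σ≤-cong : ∀ n {f g} → (∀ i → i ≤ n → f i ≈ g i) → Σ≤ n f ≈ Σ≤ n g
  Σ≤-cong zero f≈g = f≈g 0 z≤n
  Σ≤-cong (suc n) f≈g = +-cong (Σ≤-cong n (λ i i≤n → f≈g i (m≤n⇒m≤1+n i≤n))) (f≈g (suc n) ≤-refl)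

  Σ≤-+ : ∀ n f g → Σ≤ n (λ i → f i + g i) ≈ Σ≤ n f + Σ≤ n g
  Σ≤-+ zero f g = refl
  Σ≤-+ (suc n) f g = begin
    Σ≤ n (λ i → f i + g i) + (f (suc n) + g (suc n)) ≈⟨ +-congʳ (Σ≤-+ n f g) ⟩
    (Σ≤ n f + Σ≤ n g) + (f (suc n) + g (suc n))     ≈⟨ +-assoc _ _ _ ⟩
    Σ≤ n f + (Σ≤ n g + (f (suc n) + g (suc n)))     ≈⟨ +-congˡ (+-comm _ _) ⟩
    Σ≤ n f + ((f (suc n) + g (suc n)) + Σ≤ n g)     ≈⟨ +-congˡ (+-assoc _ _ _) ⟩
    Σ≤ n f + (f (suc n) + (g (suc n) + Σ≤ n g))     ≈⟨ +-assoc _ _ _ ⟨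
    (Σ≤ n f + f (suc n)) + (g (suc n) + Σ≤ n g)     ≈⟨ +-congˡ (+-comm _ _) ⟩
    (Σ≤ n f + f (suc n)) + (Σ≤ n g + g (suc n))     ∎

  *-distribˡ-Σ≤ : ∀ n a f → a * Σ≤ n f ≈ Σ≤ n (λ i → a * f i)
  *-distribˡ-Σ≤ zero a f = refl
  *-distribˡ-Σ≤ (suc n) a f = trans (distribˡ a (Σ≤ n f) (f (suc n))) (+-congʳ (*-distribˡ-Σ≤ n a f))

  Σ≤-zero : ∀ n f → (∀ i → f i ≈ 0#) → Σ≤ n f ≈ 0#
  Σ≤-zero zero f f≈0 = f≈0 0
  Σ≤-zero (suc n) f f≈0 = trans (+-cong (Σ≤-zero n f f≈0) (f≈0 (suc n))) (+-identityˡ 0#)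

  Σ≤-suc : ∀ n f → Σ≤ (suc n) f ≈ f 0 + Σ≤ n (λ i → f (suc i))
  Σ≤-suc zero f = refl
  Σ≤-suc (suc n) f = trans (+-congʳ (Σ≤-suc n f)) (+-assoc _ _ _)

  Σ≤-reverse : ∀ n f → Σ≤ n f ≈ Σ≤ n (λ i → f (n ∸ i))
  Σ≤-reverse zero f = refl
  Σ≤-reverse (suc n) f = begin
    Σ≤ n f + f (suc n)                 ≈⟨ +-congʳ (Σ≤-reverse n f) ⟩
    Σ≤ n (λ i → f (n ∸ i)) + f (suc n) ≈⟨ +-comm _ _ ⟩
    f (suc n) + Σ≤ n (λ i → f (n ∸ i)) ≈⟨ Σ≤-suc n (λ i → f (suc n ∸ i)) ⟨
    Σ≤ (suc n) (λ i → f (suc n ∸ i))   ∎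

  ⊠-cong : ∀ {f f′ g g′} → f ≋ f′ → g ≋ g′ → f ⊠ g ≋ f′ ⊠ g′
  ⊠-cong f≋f′ g≋g′ n = Σ≤-cong n (λ i _ → *-cong (f≋f′ i) (g≋g′ (n ∸ i)))

  ⊠-suc : ∀ f g n → (f ⊠ g) (suc n) ≈ f 0 * g (suc n) + ((λ i → f (suc i)) ⊠ g) n
  ⊠-suc f g n = Σ≤-suc n (λ i → f i * g (suc n ∸ i))

  ⊠-comm : ∀ f g → f ⊠ g ≋ g ⊠ f
  ⊠-comm f g n = begin
    Σ≤ n (λ i → f i * g (n ∸ i))               ≈⟨ Σ≤-reverse n _ ⟩
    Σ≤ n (λ i → f (n ∸ i) * g (n ∸ (n ∸ i)))   ≈⟨ Σ≤-cong n (λ i i≤n → trans (*-comm _ _) (*-congʳ (reflexive (≡.cong g (m∸[m∸n]≡n i≤n))))) ⟩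
    Σ≤ n (λ i → g i * f (n ∸ i))               ∎

  ⊠-distribʳ : ∀ f g h → (g ⊞ h) ⊠ f ≋ g ⊠ f ⊞ h ⊠ f
  ⊠-distribʳ f g h n = trans (Σ≤-cong n (λ i _ → distribʳ (f (n ∸ i)) (g i) (h i))) (Σ≤-+ n _ _)

  ⊠-distribˡ : ∀ f g h → f ⊠ (g ⊞ h) ≋ f ⊠ g ⊞ f ⊠ h
  ⊠-distribˡ f g h n = trans (Σ≤-cong n (λ i _ → distribˡ (f i) (g (n ∸ i)) (h (n ∸ i)))) (Σ≤-+ n _ _)

  ⊠-scaleˡ : ∀ a f g n → ((λ i → a * f i) ⊠ g) n ≈ a * (f ⊠ g) n
  ⊠-scaleˡ a f g n = trans (Σ≤-cong n (λ i _ → *-assoc a (f i) (g (n ∸ i)))) (sym (*-distribˡ-Σ≤ n a _))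

  ⊠-zeroˡ : ∀ f → 𝟘 ⊠ f ≋ 𝟘
  ⊠-zeroˡ f n = Σ≤-zero n _ (λ i → zeroˡ (f (n ∸ i)))

  ⊠-identityˡ : ∀ f → 𝟏 ⊠ f ≋ f
  ⊠-identityˡ f zero = *-identityˡ (f 0)
  ⊠-identityˡ f (suc n) = begin
    (𝟏 ⊠ f) (suc n)            ≈⟨ ⊠-suc 𝟏 f n ⟩
    1# * f (suc n) + (𝟘 ⊠ f) n ≈⟨ +-cong (*-identityˡ _) (⊠-zeroˡ f n) ⟩
    f (suc n) + 0#             ≈⟨ +-identityʳ _ ⟩
    f (suc n)                  ∎

  ⊠-assoc : ∀ f g h → (f ⊠ g) ⊠ h ≋ f ⊠ (g ⊠ h)
  ⊠-assoc f g h zero = *-assoc (f 0) (g 0) (h 0)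
  ⊠-assoc f g h (suc n) = begin
    ((f ⊠ g) ⊠ h) (suc n)
      ≈⟨ ⊠-suc (f ⊠ g) h n ⟩
    f 0 * g 0 * h (suc n) + ((λ i → (f ⊠ g) (suc i)) ⊠ h) n
      ≈⟨ +-congˡ (⊠-cong {g = h} (⊠-suc f g) (λ _ → refl) n) ⟩
    f 0 * g 0 * h (suc n) + (((λ i → f 0 * g (suc i)) ⊞ f′ ⊠ g) ⊠ h) n
      ≈⟨ +-congˡ (⊠-distribʳ h _ _ n) ⟩
    f 0 * g 0 * h (suc n) + (((λ i → f 0 * g (suc i)) ⊠ h) n + ((f′ ⊠ g) ⊠ h) n)
      ≈⟨ +-congˡ (+-cong (⊠-scaleˡ (f 0) g′ h n) (⊠-assoc f′ g h n)) ⟩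
    f 0 * g 0 * h (suc n) + (f 0 * (g′ ⊠ h) n + (f′ ⊠ (g ⊠ h)) n)
      ≈⟨ +-assoc _ _ _ ⟨
    (f 0 * g 0 * h (suc n) + f 0 * (g′ ⊠ h) n) + (f′ ⊠ (g ⊠ h)) n
      ≈⟨ +-congʳ (trans (+-congʳ (*-assoc _ _ _)) (sym (distribˡ _ _ _))) ⟩
    f 0 * (g 0 * h (suc n) + (g′ ⊠ h) n) + (f′ ⊠ (g ⊠ h)) n
      ≈⟨ +-congʳ (*-congˡ (⊠-suc g h n)) ⟨
    f 0 * (g ⊠ h) (suc n) + (f′ ⊠ (g ⊠ h)) n
      ≈⟨ ⊠-suc f (g ⊠ h) n ⟨
    (f ⊠ (g ⊠ h)) (suc n) ∎
    where
    f′ g′ : PowerSeries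
    f′ i = f (suc i)
    g′ i = g (suc i)

  ⊞-⊠-isCommutativeRing : IsCommutativeRing _≋_ _⊞_ _⊠_ ⊟_ 𝟘 𝟏
  ⊞-⊠-isCommutativeRing = record
    { isRing = record
      { +-isAbelianGroup = record
        { isGroup = record
          { isMonoid = record
            { isSemigroup = record
              { isMagma = record
                { isEquivalence = record
                  { refl = λ _ → refl ; sym = λ p n → sym (p n) ; trans = λ p q n → trans (p n) (q n) }
                ; ∙-cong = λ p q n → +-cong (p n) (q n) }
              ; assoc = λ f g h n → +-assoc (f n) (g n) (h n) }
            ; identity = (λ f n → +-identityˡ (f n)) , (λ f n → +-identityʳ (f n)) }
          ; inverse = (λ f n → -‿inverseˡ (f n)) , (λ f n → -‿inverseʳ (f n))
          ; ⁻¹-cong = λ p n → -‿cong (p n) }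
        ; comm = λ f g n → +-comm (f n) (g n) }
      ; *-cong = ⊠-cong
      ; *-assoc = ⊠-assoc
      ; *-identity = ⊠-identityˡ , (λ f n → trans (⊠-comm f 𝟏 n) (⊠-identityˡ f n))
      ; distrib = ⊠-distribˡ , ⊠-distribʳ }
    ; *-comm = ⊠-comm }

  powerSeriesRing : CommutativeRing c ℓ
  powerSeriesRing = record { isCommutativeRing = ⊞-⊠-isCommutativeRing }

module KingAlgebra {c ℓ} (R : CommutativeRing c ℓ) where

  open CommutativeRing R
  open import Algebra.Properties.Ring ring using (+-cancelʳ; -0#≈0#)
  open import Algebra.Solver.Ring.NaturalCoefficients.Default commutativeSemiring
  open import Relation.Binary.Reasoning.Setoid setoid

  D : (t u A : Carrier) → Carrier
  D t u A = 1# + t * (1# + u + u * t + (1# - u) * A)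

  module _ (t u X B H : Carrier)
           (cancel : ∀ a b → a + X * (t * b) ≈ b + X * (t * a) → a ≈ b)
           (B-eq : B ≈ 1# + X + X * (t * B))
           (H-eq : H ≈ 1# + X + X * (u * (t * H))) where

    -- Z and Z′ are equal by B-eq and H-eq; the ring identity then says
    -- (1 - X t) (lhs - rhs) = 0.
    H-B-relation : H * (1# + u * t + t * B) ≈ (1# + t) * B + u * t * H * B
    H-B-relation = cancel _ _ (+-cancelʳ Z _ _ (begin
      (Tp + X * (t * Tm)) + Z  ≈⟨ +-congˡ Z≈Z′ ⟩
      (Tp + X * (t * Tm)) + Z′ ≈⟨ solve 5 (λ t u X B H →
          let Tp = H :* (con 1 :+ u :* t :+ t :* B)
              Tm = (con 1 :+ t) :* B :+ u :* t :* H :* B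
              s = u :* t :* H :+ con 1 :+ t
          in (Tp :+ X :* (t :* Tm)) :+ (t :* H :* (con 1 :+ X :+ X :* (t :* B)) :+ s :* B :+ (con 1 :+ t) :* (con 1 :+ X :+ X :* (u :* (t :* H))))
             := (Tm :+ X :* (t :* Tp)) :+ (t :* H :* B :+ s :* (con 1 :+ X :+ X :* (t :* B)) :+ (con 1 :+ t) :* H)) refl t u X B H ⟩
      (Tm + X * (t * Tp)) + Z  ∎))
      where
      Tp = H * (1# + u * t + t * B)
      Tm = (1# + t) * B + u * t * H * B
      s = u * t * H + 1# + t
      Z = t * H * B + s * (1# + X + X * (t * B)) + (1# + t) * H
      Z′ = t * H * (1# + X + X * (t * B)) + s * B + (1# + t) * (1# + X + X * (u * (t * H)))
      Z≈Z′ : Z ≈ Z′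
      Z≈Z′ = +-cong (+-cong (*-congˡ B-eq) (*-congˡ (sym B-eq))) (*-congˡ H-eq)

    -- With A = (1 + t) B one has D = (1 + t) (1 + u t + t B - u t B), so the
    -- identity is (1 + t)² t times H-B-relation.
    E-identity : ∀ E A → E ≈ B + t * H → A ≈ B + t * B →
                 E * (1# + t) * D t u A ≈ A * (D t u A + t * (1# + t) * (1# + t))
    E-identity E A E-eq A-eq = +-cancelʳ (τ * Tm) _ _ (begin
      E * (1# + t) * D t u A + τ * Tm
        ≈⟨ +-congʳ (*-cong (*-congʳ E-eq) (D-cong A-eq)) ⟩
      (B + t * H) * (1# + t) * D t u A′ + τ * Tm
        ≈⟨ solve 5 (λ t u w B H →
             let A = B :+ t :* B
                 D = con 1 :+ t :* (con 1 :+ u :+ u :* t :+ (con 1 :+ w) :* A)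
                 τ = t :* (con 1 :+ t) :* (con 1 :+ t)
                 Tp = H :* (con 1 :+ u :* t :+ t :* B)
                 Tm = (con 1 :+ t) :* B :+ u :* t :* H :* B
             in (B :+ t :* H) :* (con 1 :+ t) :* D :+ τ :* Tm
                := A :* (D :+ τ) :+ τ :* Tp :+ t :* τ :* H :* B :* (u :+ w)) refl t u (- u) B H ⟩
      A′ * (D t u A′ + τ) + τ * Tp + t * τ * H * B * (u - u)
        ≈⟨ +-cong (+-cong (sym (*-cong A-eq (+-congʳ (D-cong A-eq)))) (*-congˡ H-B-relation))
                  (trans (*-congˡ (-‿inverseʳ u)) (zeroʳ _)) ⟩
      A * (D t u A + τ) + τ * Tm + 0#
        ≈⟨ +-identityʳ _ ⟩
      A * (D t u A + τ) + τ * Tm ∎)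
      where
      τ = t * (1# + t) * (1# + t)
      Tm = (1# + t) * B + u * t * H * B
      Tp = H * (1# + u * t + t * B)
      A′ = B + t * B
      D-cong : ∀ {A A′} → A ≈ A′ → D t u A ≈ D t u A′
      D-cong eq = +-congˡ (*-congˡ (+-congˡ (*-congˡ eq)))

  D-at-0 : ∀ t A → D t 0# A ≈ 1# + t + t * A
  D-at-0 t A = begin
    1# + t * (1# + 0# + 0# * t + (1# - 0#) * A)
      ≈⟨ +-congˡ (*-congˡ (+-cong (trans (+-congˡ (zeroˡ t)) (trans (+-identityʳ _) (+-identityʳ 1#)))
                                   (trans (*-congʳ (trans (+-congˡ -0#≈0#) (+-identityʳ 1#))) (*-identityˡ A)))) ⟩
    1# + t * (1# + A)   ≈⟨ +-congˡ (trans (distribˡ t 1# A) (+-congʳ (*-identityʳ t))) ⟩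
    1# + (t + t * A)    ≈⟨ +-assoc 1# t (t * A) ⟨
    1# + t + t * A      ∎

  P-identity : ∀ t X B P A →
    (∀ a b → a + X * (t * b) ≈ b + X * (t * a) → a ≈ b) →
    B ≈ 1# + X + X * (t * B) → P ≈ B + t * (1# + X) → A ≈ B + t * B →
    P * (1# + t) * (1# + t + t * A) ≈ A * (1# + t + t * A + t * (1# + t) * (1# + t))
  P-identity t X B P A cancel B-eq P-eq A-eq = begin
    P * (1# + t) * (1# + t + t * A)     ≈⟨ *-congˡ (D-at-0 t A) ⟨
    P * (1# + t) * D t 0# A             ≈⟨ E-identity t 0# X B (1# + X) cancel B-eq H₀-eq P A P-eq A-eq ⟩
    A * (D t 0# A + τ)                  ≈⟨ *-congˡ (+-congʳ (D-at-0 t A)) ⟩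
    A * (1# + t + t * A + τ)            ∎
    where
    τ = t * (1# + t) * (1# + t)
    H₀-eq : 1# + X ≈ 1# + X + X * (0# * (t * (1# + X)))
    H₀-eq = sym (trans (+-congˡ (trans (*-congˡ (zeroˡ _)) (zeroʳ X))) (+-identityʳ _))

-- A Series f n k = [tⁿ uᵏ] f is an element of ℤ⟦u⟧⟦t⟧, and _⊗_ is its product, so
-- the identity map makes (Series, _⊕_, _⊗_, 𝟙) a commutative ring.
module BivariateSeries where

  open import Defs
  open import Data.Nat using (ℕ; zero; suc)
  open import Data.Integer using (ℤ; +_; _+_; _*_)
  import Data.Integer.Properties as ℤ
  open import Relation.Binary.PropositionalEquality using (_≡_; refl; sym; trans; cong; cong₂)
  open import Algebra.Bundles using (RawRing)
  open import Algebra.Morphism.Structures using (IsRingMonomorphism)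
  import Algebra.Morphism.RingMonomorphism as RingMonomorphism

  module ℤ⟦u⟧ = FormalPowerSeries ℤ.+-*-commutativeRing
  module ℤ⟦u⟧⟦t⟧ = FormalPowerSeries ℤ⟦u⟧.powerSeriesRing

  sumTo-cong : ∀ n {f g : ℕ → ℤ} → (∀ i → f i ≡ g i) → sumTo n f ≡ sumTo n g
  sumTo-cong zero f≡g = f≡g 0
  sumTo-cong (suc n) f≡g = cong₂ _+_ (sumTo-cong n f≡g) (f≡g (suc n))

  Σ≤≡sumTo : ∀ n f → ℤ⟦u⟧.Σ≤ n f ≡ sumTo n f
  Σ≤≡sumTo zero f = refl
  Σ≤≡sumTo (suc n) f = cong (_+ f (suc n)) (Σ≤≡sumTo n f)

  Σ≤-coefficient : ∀ n (F : Series) k → ℤ⟦u⟧⟦t⟧.Σ≤ n F k ≡ sumTo n (λ i → F i k)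
  Σ≤-coefficient zero F k = refl
  Σ≤-coefficient (suc n) F k = cong (_+ F (suc n) k) (Σ≤-coefficient n F k)

  ⊗≋⊠ : ∀ f g → f ⊗ g ℤ⟦u⟧⟦t⟧.≋ f ℤ⟦u⟧⟦t⟧.⊠ g
  ⊗≋⊠ f g n k = sym (trans (Σ≤-coefficient n _ k) (sumTo-cong n (λ i → Σ≤≡sumTo k _)))

  𝟙≋𝟏 : 𝟙 ℤ⟦u⟧⟦t⟧.≋ ℤ⟦u⟧⟦t⟧.𝟏
  𝟙≋𝟏 zero zero = refl
  𝟙≋𝟏 zero (suc k) = refl
  𝟙≋𝟏 (suc n) k = refl

  seriesRawRing : RawRing _ _
  seriesRawRing = record
    { Carrier = Series ; _≈_ = ℤ⟦u⟧⟦t⟧._≋_ ; _+_ = _⊕_ ; _*_ = _⊗_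
    ; -_ = ℤ⟦u⟧⟦t⟧.⊟_ ; 0# = ℤ⟦u⟧⟦t⟧.𝟘 ; 1# = 𝟙 }

  id-isRingMonomorphism : IsRingMonomorphism seriesRawRing (CommutativeRing.rawRing ℤ⟦u⟧⟦t⟧.powerSeriesRing) (λ f → f)
  id-isRingMonomorphism = record
    { isRingHomomorphism = record
      { isSemiringHomomorphism = record
        { isNearSemiringHomomorphism = record
          { +-isMonoidHomomorphism = record
            { isMagmaHomomorphism = record
              { isRelHomomorphism = record { cong = λ f≋g → f≋g }
              ; homo = λ _ _ _ _ → refl }
            ; ε-homo = λ _ _ → refl }
          ; *-homo = ⊗≋⊠ }
        ; 1#-homo = 𝟙≋𝟏 }
      ; -‿homo = λ _ _ _ → refl }
    ; injective = λ f≋g → f≋g }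

  seriesRing : CommutativeRing _ _
  seriesRing = record
    { isCommutativeRing = RingMonomorphism.isCommutativeRing id-isRingMonomorphism
                            ℤ⟦u⟧⟦t⟧.⊞-⊠-isCommutativeRing }

module SeriesCoefficients where

  open import Defs
  open BivariateSeries using (seriesRing; sumTo-cong)
  open import Data.Nat using (ℕ; zero; suc; _∸_; _≤_; _<_; z≤n)
  open import Data.Nat.Properties using (m∸n≤m; m≤n⇒m≤1+n; ≤-refl)
  open import Data.Nat.Induction using (<-rec)
  open import Data.Integer using (ℤ; +_; _+_; _*_)
  import Data.Integer.Properties as ℤ
  open import Algebra.Properties.Ring ℤ.+-*-ring using () renaming (+-cancelʳ to ℤ-+-cancelʳ)
  open import Relation.Binary.PropositionalEquality using (_≡_; refl; sym; trans; cong; cong₂; module ≡-Reasoning)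
  open CommutativeRing seriesRing using (_≈_)

  sumTo-suc : ∀ n f → sumTo (suc n) f ≡ f 0 + sumTo n (λ i → f (suc i))
  sumTo-suc zero f = refl
  sumTo-suc (suc n) f = trans (cong (_+ f (suc (suc n))) (sumTo-suc n f)) (ℤ.+-assoc (f 0) _ _)

  sumTo-zero : ∀ n f → (∀ i → f i ≡ + 0) → sumTo n f ≡ + 0
  sumTo-zero zero f f≡0 = f≡0 0
  sumTo-zero (suc n) f f≡0 = cong₂ _+_ (sumTo-zero n f f≡0) (f≡0 (suc n))

  sumTo-head : ∀ n f → (∀ i → f (suc i) ≡ + 0) → sumTo n f ≡ f 0
  sumTo-head zero f _ = refl
  sumTo-head (suc n) f f≡0 = trans (sumTo-suc n f) (trans (cong (λ x → f 0 + x) (sumTo-zero n _ f≡0)) (ℤ.+-identityʳ (f 0)))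

  sumTo-local : ∀ n {f g : ℕ → ℤ} → (∀ i → i ≤ n → f i ≡ g i) → sumTo n f ≡ sumTo n g
  sumTo-local zero f≡g = f≡g 0 z≤n
  sumTo-local (suc n) f≡g = cong₂ _+_ (sumTo-local n (λ i i≤n → f≡g i (m≤n⇒m≤1+n i≤n))) (f≡g (suc n) ≤-refl)

  𝕥⊗-zero : ∀ f k → (𝕥 ⊗ f) 0 k ≡ + 0
  𝕥⊗-zero f k = sumTo-zero k _ (λ _ → refl)

  𝕥⊗-suc : ∀ f n k → (𝕥 ⊗ f) (suc n) k ≡ f n k
  𝕥⊗-suc f n k = begin
    (𝕥 ⊗ f) (suc n) k ≡⟨ sumTo-suc n _ ⟩
    sumTo k (λ j → 𝕥 0 j * f (suc n) (k ∸ j)) + sumTo n (λ i → sumTo k (λ j → 𝕥 (suc i) j * f (n ∸ i) (k ∸ j)))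
      ≡⟨ cong₂ _+_ (sumTo-zero k _ (λ _ → refl)) (sumTo-head n _ (λ _ → sumTo-zero k _ (λ _ → refl))) ⟩
    + 0 + sumTo k (λ j → 𝕥 1 j * f n (k ∸ j)) ≡⟨ ℤ.+-identityˡ _ ⟩
    sumTo k (λ j → 𝕥 1 j * f n (k ∸ j))       ≡⟨ sumTo-head k _ (λ _ → refl) ⟩
    + 1 * f n k                                ≡⟨ ℤ.*-identityˡ (f n k) ⟩
    f n k ∎
    where open ≡-Reasoning

  𝕦⊗-zero : ∀ f n → (𝕦 ⊗ f) n 0 ≡ + 0
  𝕦⊗-zero f n = sumTo-zero n _ (λ { zero → refl ; (suc i) → refl })

  𝕦⊗-suc : ∀ f n k → (𝕦 ⊗ f) n (suc k) ≡ f n k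
  𝕦⊗-suc f n k = begin
    (𝕦 ⊗ f) n (suc k)                          ≡⟨ sumTo-head n _ (λ _ → sumTo-zero (suc k) _ (λ _ → refl)) ⟩
    sumTo (suc k) (λ j → 𝕦 0 j * f n (suc k ∸ j)) ≡⟨ sumTo-suc k _ ⟩
    + 0 + sumTo k (λ j → 𝕦 0 (suc j) * f n (k ∸ j)) ≡⟨ ℤ.+-identityˡ _ ⟩
    sumTo k (λ j → 𝕦 0 (suc j) * f n (k ∸ j))   ≡⟨ sumTo-head k _ (λ _ → refl) ⟩
    + 1 * f n k                                  ≡⟨ ℤ.*-identityˡ (f n k) ⟩
    f n k ∎
    where open ≡-Reasoning

  tSeries : (ℕ → ℕ) → Series
  tSeries a n zero = + a n
  tSeries a n (suc _) = + 0

  tSeries⊗ : ∀ a f n k → (tSeries a ⊗ f) n k ≡ sumTo n (λ i → + a i * f (n ∸ i) k)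
  tSeries⊗ a f n k = sumTo-cong n (λ i → sumTo-head k _ (λ _ → refl))

  ⊗-local : ∀ f {g g′} n k → (∀ i → i ≤ n → ∀ j → g i j ≡ g′ i j) → (f ⊗ g) n k ≡ (f ⊗ g′) n k
  ⊗-local f n k g≡g′ = sumTo-local n (λ i _ → sumTo-cong k (λ j → cong (f i j *_) (g≡g′ (n ∸ i) (m∸n≤m n i) (k ∸ j))))

  -- Multiplication by 1 - X t is injective: the coefficient of tⁿ in X t b
  -- only involves the coefficients of b below tⁿ.
  cancel-1-X𝕥 : ∀ X a b → a ⊕ X ⊗ (𝕥 ⊗ b) ≈ b ⊕ X ⊗ (𝕥 ⊗ a) → a ≈ b
  cancel-1-X𝕥 X a b eq = <-rec (λ n → ∀ k → a n k ≡ b n k) step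
    where
    step : ∀ n → (∀ {m} → m < n → ∀ k → a m k ≡ b m k) → ∀ k → a n k ≡ b n k
    step n ih k = ℤ-+-cancelʳ ((X ⊗ (𝕥 ⊗ b)) n k) (a n k) (b n k)
      (trans (eq n k) (cong (λ c → b n k + c) (⊗-local X n k 𝕥a≡𝕥b)))
      where
      𝕥a≡𝕥b : ∀ i → i ≤ n → ∀ j → (𝕥 ⊗ a) i j ≡ (𝕥 ⊗ b) i j
      𝕥a≡𝕥b zero _ j = trans (𝕥⊗-zero a j) (sym (𝕥⊗-zero b j))
      𝕥a≡𝕥b (suc i) i<n j = trans (𝕥⊗-suc a i j) (trans (ih i<n j) (sym (𝕥⊗-suc b i j)))

module Booleans where

  open import Data.Nat using (ℕ; zero; suc; _+_; _≤_; _<_; z≤n; s≤s; _<ᵇ_)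
  open import Data.Bool using (Bool; true; false; _∧_; not; if_then_else_; T)
  open import Data.Product using (_×_; _,_)
  open import Data.Unit using (tt)
  open import Relation.Binary.PropositionalEquality using (_≡_; refl)

  ≤⇒<ᵇ≡false : ∀ x y → y ≤ x → (x <ᵇ y) ≡ false
  ≤⇒<ᵇ≡false x zero _ = refl
  ≤⇒<ᵇ≡false (suc x) (suc y) (s≤s y≤x) = ≤⇒<ᵇ≡false x y y≤x

  <⇒<ᵇ≡true : ∀ x y → x < y → (x <ᵇ y) ≡ true
  <⇒<ᵇ≡true zero (suc y) _ = refl
  <⇒<ᵇ≡true (suc x) (suc y) (s≤s x<y) = <⇒<ᵇ≡true x y x<y

  <ᵇ≡false⇒≥ : ∀ x y → (x <ᵇ y) ≡ false → y ≤ x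
  <ᵇ≡false⇒≥ x zero _ = z≤n
  <ᵇ≡false⇒≥ (suc x) (suc y) x≮ᵇy = s≤s (<ᵇ≡false⇒≥ x y x≮ᵇy)

  <ᵇ-+ˡ : ∀ k x y → ((k + x) <ᵇ (k + y)) ≡ (x <ᵇ y)
  <ᵇ-+ˡ zero x y = refl
  <ᵇ-+ˡ (suc k) x y = <ᵇ-+ˡ k x y

  T-∧⁻ˡ : ∀ {a b} → T (a ∧ b) → T a
  T-∧⁻ˡ {true} _ = tt

  T-∧⁻ʳ : ∀ {a b} → T (a ∧ b) → T b
  T-∧⁻ʳ {true} t = t

  ≡true⇒T : ∀ {b} → b ≡ true → T b
  ≡true⇒T refl = tt

  T-∧⁺ : ∀ {a b} → T a → T b → T (a ∧ b)
  T-∧⁺ {true} _ tb = tb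

  ∧-rearrange : ∀ a b c → (a ∧ b) ∧ c ≡ (c ∧ (a ∧ true)) ∧ b
  ∧-rearrange true true true = refl
  ∧-rearrange true true false = refl
  ∧-rearrange true false true = refl
  ∧-rearrange true false false = refl
  ∧-rearrange false b true = refl
  ∧-rearrange false b false = refl

  ∧≡true⁻ : ∀ {a b} → a ∧ b ≡ true → a ≡ true × b ≡ true
  ∧≡true⁻ {true} {true} _ = refl , refl

  not≡true⁻ : ∀ {a} → not a ≡ true → a ≡ false
  not≡true⁻ {false} _ = refl

  indicator : Bool → ℕ
  indicator b = if b then 1 else 0

  indicator-∧-split : ∀ a b → indicator (a ∧ b) + indicator (a ∧ not b) ≡ indicator a
  indicator-∧-split true true = refl
  indicator-∧-split true false = refl
  indicator-∧-split false b = refl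

  indicator+≡0 : ∀ b n → indicator b + n ≡ 0 → b ≡ false × n ≡ 0
  indicator+≡0 false n e = refl , e

module Lists where

  open import Defs
  open Booleans
  open import Data.Nat using (ℕ; zero; suc; _+_; _*_; _∸_; _≤_; _<_; z≤n; s≤s)
  open import Data.Nat.Properties using (≤-antisym; ≤-reflexive; +-commutativeSemigroup)
  open import Algebra.Properties.CommutativeSemigroup +-commutativeSemigroup using () renaming (interchange to +-interchange)
  open import Data.Bool using (Bool; true; false; _∧_; _∨_; not)
  open import Data.Bool.Properties using (∨-assoc; ∨-zeroʳ; ∧-zeroʳ; T?)
  open import Data.Bool.ListAction using (any; all)
  open import Data.List using (List; []; _∷_; _++_; [_]; map; concatMap; filter; length; take; drop; upTo; cartesianProduct)
  open import Data.Nat.ListAction using (sum)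
  open import Data.List.Properties using (length-++; length-drop; length-map; map-upTo; take-all; ∷-injective)
  open import Data.List.Membership.Propositional using (_∈_; _∉_)
  open import Data.List.Membership.Propositional.Properties using (∈-++⁺ʳ; ∈-++⁺ˡ; ∈-++⁻; ∈-concat⁻′; ∈-map⁻; ∈-∃++)
  open import Data.List.Relation.Unary.Any using (here; there)
  import Data.List.Relation.Unary.All as All
  open import Data.List.Relation.Unary.AllPairs using ([]; _∷_)
  open import Data.List.Relation.Unary.Unique.Propositional using (Unique)
  import Data.List.Relation.Unary.Unique.Propositional.Properties as UP
  open import Data.Product using (∃; ∃₂; _×_; _,_)
  open import Data.Sum using (inj₁; inj₂)
  open import Data.Empty using (⊥; ⊥-elim)
  open import Function using (_∘_)
  open import Relation.Binary.PropositionalEquality using (_≡_; refl; sym; trans; cong; cong₂; subst)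

  Unique-head : ∀ {A : Set} {x : A} {xs} → Unique (x ∷ xs) → x ∉ xs
  Unique-head (h ∷ _) x∈ = All.lookup h x∈ refl

  Unique-tail : ∀ {A : Set} {x : A} {xs} → Unique (x ∷ xs) → Unique xs
  Unique-tail (_ ∷ t) = t

  Unique-++⁻ : ∀ {A : Set} (xs : List A) {ys} → Unique (xs ++ ys) → Unique xs × Unique ys × (∀ {x} → x ∈ xs → x ∉ ys)
  Unique-++⁻ [] u = [] , u , λ ()
  Unique-++⁻ (x ∷ xs) (h ∷ u) with Unique-++⁻ xs u
  ... | a , b , c = (All.tabulate (λ z∈ → All.lookup h (∈-++⁺ˡ z∈)) ∷ a) , b ,
        λ { (here refl) y∈ → All.lookup h (∈-++⁺ʳ xs y∈) refl ; (there z∈) → c z∈ }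

  ++-∷-cancel : ∀ {A : Set} {x : A} xs₁ ys₁ xs₂ ys₂ → x ∉ xs₁ → x ∉ xs₂ →
               xs₁ ++ x ∷ ys₁ ≡ xs₂ ++ x ∷ ys₂ → xs₁ ≡ xs₂ × ys₁ ≡ ys₂
  ++-∷-cancel [] ys₁ [] ys₂ _ _ refl = refl , refl
  ++-∷-cancel [] ys₁ (z ∷ xs₂) ys₂ _ n2 refl = ⊥-elim (n2 (here refl))
  ++-∷-cancel (z ∷ xs₁) ys₁ [] ys₂ n1 _ refl = ⊥-elim (n1 (here refl))
  ++-∷-cancel (z ∷ xs₁) ys₁ (w ∷ xs₂) ys₂ n1 n2 eq with ∷-injective eq
  ... | refl , eq' with ++-∷-cancel xs₁ ys₁ xs₂ ys₂ (n1 ∘ there) (n2 ∘ there) eq'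
  ... | refl , refl = refl , refl

  concatMap-Unique : ∀ {A B : Set} (f : A → List B) (xs : List A) →
    (∀ {x} → x ∈ xs → Unique (f x)) →
    (∀ {x y z} → x ∈ xs → y ∈ xs → z ∈ f x → z ∈ f y → x ≡ y) →
    Unique xs → Unique (concatMap f xs)
  concatMap-Unique f [] _ _ _ = []
  concatMap-Unique f (x ∷ xs) fu disjoint u =
    UP.++⁺ (fu (here refl)) (concatMap-Unique f xs (fu ∘ there) (λ a b → disjoint (there a) (there b)) (Unique-tail u))
      (λ { (z∈fx , z∈rest) → disjoint-rest z∈fx (∈-concat⁻′ (map f xs) z∈rest) })
    where
    disjoint-rest : ∀ {z} → z ∈ f x → (∃ λ l → z ∈ l × l ∈ map f xs) → ⊥
    disjoint-rest z∈fx (l , z∈l , l∈) with ∈-map⁻ f l∈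
    ... | y , y∈ , refl with disjoint (here refl) (there y∈) z∈fx z∈l
    ... | refl = Unique-head u y∈

  map-Unique : ∀ {A B : Set} (f : A → B) {xs} → Unique xs →
    (∀ {x y} → x ∈ xs → y ∈ xs → f x ≡ f y → x ≡ y) → Unique (map f xs)
  map-Unique f {[]} _ _ = []
  map-Unique f {x ∷ xs} u inj =
    All.tabulate (λ {z} z∈ eq → fx∉ z∈ eq) ∷ map-Unique f (Unique-tail u) (λ a b → inj (there a) (there b))
    where
    fx∉ : ∀ {z} → z ∈ map f xs → f x ≡ z → ⊥
    fx∉ z∈ eq with ∈-map⁻ f z∈
    ... | y , y∈ , refl with inj (here refl) (there y∈) eq
    ... | refl = Unique-head u y∈

  filter-Unique : ∀ {A : Set} (p : A → Bool) {xs} → Unique xs → Unique (filter (λ x → T? (p x)) xs)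
  filter-Unique p u = UP.filter⁺ (λ x → T? (p x)) u

  ∈-++-∷⁺ : ∀ {A : Set} {x y : A} xs ys → x ∈ xs ++ ys → x ∈ xs ++ y ∷ ys
  ∈-++-∷⁺ xs ys x∈ with ∈-++⁻ xs x∈
  ... | inj₁ x∈xs = ∈-++⁺ˡ x∈xs
  ... | inj₂ x∈ys = ∈-++⁺ʳ xs (there x∈ys)

  length-++-∷ : ∀ {A : Set} (a : List A) x b → length (a ++ x ∷ b) ≡ suc (length (a ++ b))
  length-++-∷ [] x b = refl
  length-++-∷ (y ∷ a) x b = cong suc (length-++-∷ a x b)

  Unique-⊆⇒length≤ : ∀ {A : Set} {xs ys : List A} → Unique xs → (∀ {x} → x ∈ xs → x ∈ ys) → length xs ≤ length ys
  Unique-⊆⇒length≤ {xs = []} _ _ = z≤n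
  Unique-⊆⇒length≤ {xs = x ∷ xs} {ys} u xs⊆ys with ∈-∃++ (xs⊆ys (here refl))
  ... | a , b , refl = subst (suc (length xs) ≤_) (sym (length-++-∷ a x b))
          (s≤s (Unique-⊆⇒length≤ (Unique-tail u) xs⊆a++b))
    where
    xs⊆a++b : ∀ {z} → z ∈ xs → z ∈ a ++ b
    xs⊆a++b {z} z∈ with ∈-++⁻ a (xs⊆ys (there z∈))
    ... | inj₁ p = ∈-++⁺ˡ p
    ... | inj₂ (here refl) = ⊥-elim (Unique-head u z∈)
    ... | inj₂ (there p) = ∈-++⁺ʳ a p

  length≤-injection : ∀ {A B : Set} {xs : List A} {ys : List B} (f : A → B) (g : B → A) → Unique xs →
    (∀ {x} → x ∈ xs → f x ∈ ys) → (∀ {x} → x ∈ xs → g (f x) ≡ x) → length xs ≤ length ys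
  length≤-injection {xs = xs} {ys} f g u fin gf =
    subst (_≤ length ys) (length-map f xs)
      (Unique-⊆⇒length≤ (map-Unique f u (λ {x} {y} a b e → trans (sym (gf a)) (trans (cong g e) (gf b))))
         (λ z∈ → image⊆ys z∈))
    where
    image⊆ys : ∀ {z} → z ∈ map f xs → z ∈ ys
    image⊆ys z∈ with ∈-map⁻ f z∈
    ... | x , x∈ , refl = fin x∈

  length-bijection : ∀ {A B : Set} {xs : List A} {ys : List B} (f : A → B) (g : B → A) → Unique xs → Unique ys →
    (∀ {x} → x ∈ xs → f x ∈ ys) → (∀ {y} → y ∈ ys → g y ∈ xs) →
    (∀ {x} → x ∈ xs → g (f x) ≡ x) → (∀ {y} → y ∈ ys → f (g y) ≡ y) → length xs ≡ length ys
  length-bijection f g ux uy fin gin gf fg = ≤-antisym (length≤-injection f g ux fin gf) (length≤-injection g f uy gin fg)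

  snoc-view : ∀ (a : ℕ) α → ∃₂ λ α' l → a ∷ α ≡ α' ++ [ l ]
  snoc-view a [] = [] , a , refl
  snoc-view a (b ∷ α) with snoc-view b α
  ... | α' , l , e = a ∷ α' , l , cong (a ∷_) e

  any-++ : ∀ {A : Set} (p : A → Bool) xs ys → any p (xs ++ ys) ≡ any p xs ∨ any p ys
  any-++ p [] ys = refl
  any-++ p (x ∷ xs) ys rewrite any-++ p xs ys = sym (∨-assoc (p x) (any p xs) (any p ys))

  any-false⁺ : ∀ {A : Set} {p : A → Bool} xs → (∀ {x} → x ∈ xs → p x ≡ false) → any p xs ≡ false
  any-false⁺ [] h = refl
  any-false⁺ (x ∷ xs) h rewrite h (here refl) = any-false⁺ xs (h ∘ there)

  any-true⁺ : ∀ {A : Set} {p : A → Bool} {xs x} → x ∈ xs → p x ≡ true → any p xs ≡ true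
  any-true⁺ {p = p} {y ∷ xs} (here refl) e rewrite e = refl
  any-true⁺ {p = p} {y ∷ xs} (there x∈) e rewrite any-true⁺ {p = p} x∈ e = ∨-zeroʳ (p y)

  all-false⁺ : ∀ {A : Set} {p : A → Bool} {xs x} → x ∈ xs → p x ≡ false → all p xs ≡ false
  all-false⁺ {p = p} {y ∷ xs} (here refl) e rewrite e = refl
  all-false⁺ {p = p} {y ∷ xs} (there x∈) e rewrite all-false⁺ {p = p} x∈ e = ∧-zeroʳ (p y)

  any-cong : ∀ {A : Set} {p q : A → Bool} xs → (∀ {x} → x ∈ xs → p x ≡ q x) → any p xs ≡ any q xs
  any-cong [] h = refl
  any-cong (x ∷ xs) h = cong₂ _∨_ (h (here refl)) (any-cong xs (h ∘ there))

  any-map : ∀ {A B : Set} (p : B → Bool) (f : A → B) xs → any p (map f xs) ≡ any (p ∘ f) xs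
  any-map p f [] = refl
  any-map p f (x ∷ xs) = cong (p (f x) ∨_) (any-map p f xs)

  any-false⁻ : ∀ {A : Set} {p : A → Bool} xs → any p xs ≡ false → ∀ {x} → x ∈ xs → p x ≡ false
  any-false⁻ {p = p} xs e {x} x∈ with p x in eq
  ... | false = refl
  ... | true = trans (sym (any-true⁺ {p = p} x∈ eq)) e

  countBy : ∀ {A : Set} → (A → Bool) → List A → ℕ
  countBy p [] = 0
  countBy p (x ∷ xs) = indicator (p x) + countBy p xs

  length-filter≡countBy : ∀ {A : Set} (p : A → Bool) xs → length (filter (λ x → T? (p x)) xs) ≡ countBy p xs
  length-filter≡countBy p [] = refl
  length-filter≡countBy p (x ∷ xs) with p x
  ... | true = cong suc (length-filter≡countBy p xs)
  ... | false = length-filter≡countBy p xs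

  countBy-cong : ∀ {A : Set} {p q : A → Bool} xs → (∀ {x} → x ∈ xs → p x ≡ q x) → countBy p xs ≡ countBy q xs
  countBy-cong [] h = refl
  countBy-cong (x ∷ xs) h = cong₂ _+_ (cong indicator (h (here refl))) (countBy-cong xs (h ∘ there))

  countBy-false : ∀ {A : Set} {p : A → Bool} xs → (∀ {x} → x ∈ xs → p x ≡ false) → countBy p xs ≡ 0
  countBy-false [] h = refl
  countBy-false {p = p} (x ∷ xs) h rewrite h (here refl) = countBy-false xs (h ∘ there)

  countBy-map : ∀ {A B : Set} (p : B → Bool) (f : A → B) xs → countBy p (map f xs) ≡ countBy (p ∘ f) xs
  countBy-map p f [] = refl
  countBy-map p f (x ∷ xs) = cong (indicator (p (f x)) +_) (countBy-map p f xs)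

  countBy-split : ∀ {A : Set} (p q : A → Bool) xs → countBy p xs ≡ countBy (λ x → p x ∧ q x) xs + countBy (λ x → p x ∧ not (q x)) xs
  countBy-split p q [] = refl
  countBy-split p q (x ∷ xs) =
    trans (cong₂ _+_ (sym (indicator-∧-split (p x) (q x))) (countBy-split p q xs)) (+-interchange (indicator (p x ∧ q x)) _ (countBy (λ x → p x ∧ q x) xs) _)

  ∈-take : ∀ {v : ℕ} c l → v ∈ take c l → v ∈ l
  ∈-take (suc c) (x ∷ l) (here refl) = here refl
  ∈-take (suc c) (x ∷ l) (there p) = there (∈-take c l p)

  ∈-drop : ∀ {v : ℕ} c l → v ∈ drop c l → v ∈ l
  ∈-drop zero l p = p
  ∈-drop (suc c) (x ∷ l) p = there (∈-drop c l p)

  take-all-drop : ∀ (l : List ℕ) c → take (length l ∸ c) (drop c l) ≡ drop c l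
  take-all-drop l c = take-all _ (drop c l) (≤-reflexive (length-drop c l))

  at-∈ : ∀ l j → j < length l → at l (suc j) ∈ l
  at-∈ (x ∷ l) zero _ = here refl
  at-∈ (x ∷ l) (suc j) (s≤s lt) = there (at-∈ l j lt)

  at-split : ∀ l j → j < length l → l ≡ take j l ++ at l (suc j) ∷ drop (suc j) l
  at-split (x ∷ l) zero _ = refl
  at-split (x ∷ l) (suc j) (s≤s lt) = cong (x ∷_) (at-split l j lt)

  upTo-suc : ∀ m → upTo (suc m) ≡ 0 ∷ map suc (upTo m)
  upTo-suc m = cong (0 ∷_) (sym (map-upTo suc m))

  length-cartesianProduct : ∀ {A B : Set} (xs : List A) (ys : List B) → length (cartesianProduct xs ys) ≡ length xs * length ys
  length-cartesianProduct [] ys = refl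
  length-cartesianProduct (x ∷ xs) ys = trans (length-++ (map (x ,_) ys)) (cong₂ _+_ (length-map (x ,_) ys) (length-cartesianProduct xs ys))

  length-concatMap : ∀ {A B : Set} (f : A → List B) xs → length (concatMap f xs) ≡ sum (map (length ∘ f) xs)
  length-concatMap f [] = refl
  length-concatMap f (x ∷ xs) = trans (length-++ (f x)) (cong (length (f x) +_) (length-concatMap f xs))

  length-concatMap-empty : ∀ (g : ℕ → List ℕ) xs → (∀ {m} → m ∈ xs → length (g m) ≡ 0) → length (concatMap g xs) ≡ 0
  length-concatMap-empty g [] h = refl
  length-concatMap-empty g (m ∷ xs) h = trans (length-++ (g m)) (cong₂ _+_ (h (here refl)) (length-concatMap-empty g xs (h ∘ there)))

module Permutations where

  open import Defs
  open Lists
  open import Data.Nat using (ℕ; zero; suc; _+_; _∸_; _≤_; _<_; z≤n; s≤s; _≡ᵇ_; _≟_; _<?_)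
  open import Data.Nat.Properties using (+-identityʳ; +-suc; 1+n≰n; ≤∧≢⇒<; <-irrefl; <⇒≤; <⇒≱; m+[n∸m]≡n; m+n∸m≡n; m<n⇒0<n∸m; suc-injective; ∸-cancelʳ-≡; ∸-monoˡ-≤; ≤-pred; ≤-refl; ≤-trans; ≮⇒≥)
  open import Data.Bool using (Bool; true; false; _∧_; not; T)
  open import Data.Bool.Properties using (T?)
  open import Data.List using (List; []; _∷_; _++_; [_]; _∷ʳ_; map; filter; length; upTo)
  open import Data.List.Properties using (++-assoc; ++-identityʳ; length-++; length-map; length-upTo; map-++; map-upTo; map-∘; upTo-∷ʳ; map-id-local)
  open import Data.List.Membership.Propositional using (_∈_; _∉_)
  open import Data.List.Membership.Propositional.Properties using (∈-++⁺ʳ; ∈-++⁺ˡ; ∈-++⁻; ∈-concat⁺′; ∈-concat⁻′; ∈-filter⁺; ∈-filter⁻; ∈-map⁺; ∈-map⁻; ∈-upTo⁺; ∈-upTo⁻; ∈-∃++)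
  open import Data.List.Relation.Unary.Any using (here; there; any?)
  open import Data.List.Relation.Unary.All using ([]; _∷_)
  import Data.List.Relation.Unary.All as All
  open import Data.List.Relation.Unary.AllPairs using ([]; _∷_)
  open import Data.List.Relation.Unary.Unique.Propositional using (Unique)
  import Data.List.Relation.Unary.Unique.Propositional.Properties as UP
  open import Data.List.Relation.Binary.Permutation.Propositional using (_↭_; ↭-sym; ↭-trans; ↭-refl; ↭-prep; ↭⇒↭ₛ)
  import Data.List.Relation.Binary.Permutation.Propositional.Properties as PP
  import Data.List.Relation.Binary.Permutation.Setoid.Properties as PSP
  open import Data.Product using (∃; ∃₂; _×_; _,_; proj₁; proj₂)
  open import Data.Sum using (inj₁; inj₂)
  open import Data.Empty using (⊥; ⊥-elim)
  open import Function using (_∘_)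
  open import Relation.Nullary using (yes; no)
  open import Relation.Binary.PropositionalEquality using (_≡_; refl; sym; trans; cong; subst; subst₂; setoid; module ≡-Reasoning)

  IsPerm : ℕ → List ℕ → Set
  IsPerm n σ = σ ↭ positions n

  positions-suc : ∀ n → positions (suc n) ≡ 1 ∷ map suc (positions n)
  positions-suc n = cong (λ l → 1 ∷ map suc l) (sym (map-upTo suc n))

  positions-∷ʳ : ∀ n → positions (suc n) ≡ positions n ∷ʳ suc n
  positions-∷ʳ n = trans (cong (map suc) (sym (upTo-∷ʳ n))) (map-++ suc (upTo n) [ n ])

  ∈-positions⁻ : ∀ {n x} → x ∈ positions n → 1 ≤ x × x ≤ n
  ∈-positions⁻ {n} p with ∈-map⁻ suc p
  ... | j , j∈ , refl = s≤s z≤n , ∈-upTo⁻ j∈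

  ∈-positions⁺ : ∀ {n x} → 1 ≤ x → x ≤ n → x ∈ positions n
  ∈-positions⁺ {n} {suc x} (s≤s _) x≤n = ∈-map⁺ suc (∈-upTo⁺ x≤n)

  IsPerm-bounds : ∀ {n σ x} → IsPerm n σ → x ∈ σ → 1 ≤ x × x ≤ n
  IsPerm-bounds p x∈ = ∈-positions⁻ (PP.∈-resp-↭ p x∈)

  IsPerm-∋ : ∀ {n σ x} → IsPerm n σ → 1 ≤ x → x ≤ n → x ∈ σ
  IsPerm-∋ p a b = PP.∈-resp-↭ (↭-sym p) (∈-positions⁺ a b)

  positions-unique : ∀ n → Unique (positions n)
  positions-unique n = UP.map⁺ (λ { refl → refl }) (UP.upTo⁺ n)

  IsPerm⇒Unique : ∀ {n σ} → IsPerm n σ → Unique σ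
  IsPerm⇒Unique {n} p = PSP.Unique-resp-↭ (setoid ℕ) (↭⇒↭ₛ (↭-sym p)) (positions-unique n)

  IsPerm⇒length : ∀ {n σ} → IsPerm n σ → length σ ≡ n
  IsPerm⇒length {n} p = trans (PP.↭-length p) (trans (length-map suc (upTo n)) (length-upTo n))

  ∈-insertAll⁺ : ∀ x xs ys → xs ++ x ∷ ys ∈ insertAll x (xs ++ ys)
  ∈-insertAll⁺ x [] [] = here refl
  ∈-insertAll⁺ x [] (y ∷ ys) = here refl
  ∈-insertAll⁺ x (z ∷ xs) ys = there (∈-map⁺ (z ∷_) (∈-insertAll⁺ x xs ys))

  ∈-insertAll⁻ : ∀ x τ {σ} → σ ∈ insertAll x τ → ∃₂ λ xs ys → τ ≡ xs ++ ys × σ ≡ xs ++ x ∷ ys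
  ∈-insertAll⁻ x [] (here refl) = [] , [] , refl , refl
  ∈-insertAll⁻ x (y ∷ ys) (here refl) = [] , y ∷ ys , refl , refl
  ∈-insertAll⁻ x (y ∷ ys) (there p) with ∈-map⁻ (y ∷_) p
  ... | σ' , σ'∈ , refl with ∈-insertAll⁻ x ys σ'∈
  ... | a , b , refl , refl = y ∷ a , b , refl , refl

  IsPerm-insert : ∀ n xs ys → IsPerm n (xs ++ ys) → IsPerm (suc n) (xs ++ suc n ∷ ys)
  IsPerm-insert n xs ys p = ↭-trans (PP.shift (suc n) xs ys)
    (↭-trans (↭-prep (suc n) p) (subst (suc n ∷ positions n ↭_) (sym (positions-∷ʳ n)) (PP.∷↭∷ʳ (suc n) (positions n))))

  ∈-perms⁻ : ∀ n {σ} → σ ∈ perms n → IsPerm n σ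
  ∈-perms⁻ zero (here refl) = ↭-refl
  ∈-perms⁻ (suc n) {σ} p with ∈-concat⁻′ (map (insertAll (suc n)) (perms n)) p
  ... | l , σ∈l , l∈ with ∈-map⁻ (insertAll (suc n)) l∈
  ... | τ , τ∈ , refl with ∈-insertAll⁻ (suc n) τ σ∈l
  ... | xs , ys , refl , refl = IsPerm-insert n xs ys (∈-perms⁻ n τ∈)

  ∈-perms⁺ : ∀ n {σ} → IsPerm n σ → σ ∈ perms n
  ∈-perms⁺ zero p rewrite PP.↭-empty-inv p = here refl
  ∈-perms⁺ (suc n) {σ} p with ∈-∃++ (IsPerm-∋ p (s≤s z≤n) ≤-refl)
  ... | xs , ys , refl = ∈-concat⁺′ (∈-insertAll⁺ (suc n) xs ys) (∈-map⁺ (insertAll (suc n)) (∈-perms⁺ n xs++ysP))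
    where
    xs++ysP : IsPerm n (xs ++ ys)
    xs++ysP = subst (xs ++ ys ↭_) (++-identityʳ _) (PP.drop-mid xs (positions n) (subst (xs ++ suc n ∷ ys ↭_) (positions-∷ʳ n) p))


  insertAll-Unique : ∀ x τ → x ∉ τ → Unique (insertAll x τ)
  insertAll-Unique x [] _ = [] ∷ []
  insertAll-Unique x (y ∷ ys) x∉ =
    All.tabulate (λ {σ} σ∈ eq → x∷y∷ys∉ σ∈ eq) ∷ UP.map⁺ (λ { refl → refl }) (insertAll-Unique x ys (x∉ ∘ there))
    where
    x∷y∷ys∉ : ∀ {σ} → σ ∈ map (y ∷_) (insertAll x ys) → x ∷ y ∷ ys ≡ σ → ⊥
    x∷y∷ys∉ σ∈ eq with ∈-map⁻ (y ∷_) σ∈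
    x∷y∷ys∉ σ∈ refl | _ , _ , refl = x∉ (here refl)

  perms-Unique : ∀ n → Unique (perms n)
  perms-Unique zero = [] ∷ []
  perms-Unique (suc n) = concatMap-Unique (insertAll (suc n)) (perms n)
    (λ τ∈ → insertAll-Unique (suc n) _ (max∉ τ∈))
    insertAll-disjoint (perms-Unique n)
    where
    max∉ : ∀ {τ} → τ ∈ perms n → suc n ∉ τ
    max∉ τ∈ x∈ with IsPerm-bounds (∈-perms⁻ n τ∈) x∈
    ... | _ , le = <-irrefl refl le
    insertAll-disjoint : ∀ {τ₁ τ₂ σ} → τ₁ ∈ perms n → τ₂ ∈ perms n → σ ∈ insertAll (suc n) τ₁ → σ ∈ insertAll (suc n) τ₂ → τ₁ ≡ τ₂
    insertAll-disjoint {τ₁} {τ₂} t1 t2 s1 s2 with ∈-insertAll⁻ (suc n) τ₁ s1 | ∈-insertAll⁻ (suc n) τ₂ s2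
    ... | a1 , b1 , refl , refl | a2 , b2 , refl , e2 with ++-∷-cancel a1 b1 a2 b2
          (λ x∈ → max∉ t1 (∈-++⁺ˡ x∈)) (λ x∈ → max∉ t2 (∈-++⁺ˡ x∈)) e2
    ... | refl , refl = refl

  count≡countBy : ∀ P xs → count P xs ≡ countBy P xs
  count≡countBy P [] = refl
  count≡countBy P (x ∷ xs) with P x
  ... | true = cong suc (count≡countBy P xs)
  ... | false = count≡countBy P xs

  count-perms-cong : ∀ (P Q : List ℕ → Bool) n → (∀ {σ} → IsPerm n σ → P σ ≡ Q σ) → count P (perms n) ≡ count Q (perms n)
  count-perms-cong P Q n h = trans (count≡countBy P (perms n)) (trans (countBy-cong (perms n) (λ x∈ → h (∈-perms⁻ n x∈))) (sym (count≡countBy Q (perms n))))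

  count-false : ∀ xs → count (λ _ → false) xs ≡ 0
  count-false [] = refl
  count-false (_ ∷ xs) = count-false xs

  count-split : ∀ (P Q : List ℕ → Bool) xs → count P xs ≡ count (λ x → P x ∧ Q x) xs + count (λ x → P x ∧ not (Q x)) xs
  count-split P Q xs rewrite count≡countBy P xs | count≡countBy (λ x → P x ∧ Q x) xs | count≡countBy (λ x → P x ∧ not (Q x)) xs = countBy-split P Q xs

  count-bijection : ∀ {B : Set} (P : List ℕ → Bool) n (ys : List B) (f : List ℕ → B) (g : B → List ℕ) →
    Unique ys →
    (∀ {σ} → IsPerm n σ → T (P σ) → f σ ∈ ys) →
    (∀ {y} → y ∈ ys → IsPerm n (g y) × T (P (g y))) →
    (∀ {σ} → IsPerm n σ → T (P σ) → g (f σ) ≡ σ) →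
    (∀ {y} → y ∈ ys → f (g y) ≡ y) →
    count P (perms n) ≡ length ys
  count-bijection P n ys f g uy fin gin gf fg =
    length-bijection f g (filter-Unique P (perms-Unique n)) uy
      (λ x∈ → let (a , b) = ∈-filter⁻ (λ x → T? (P x)) x∈ in fin (∈-perms⁻ n a) b)
      (λ y∈ → let (a , b) = gin y∈ in ∈-filter⁺ (λ x → T? (P x)) (∈-perms⁺ n a) b)
      (λ x∈ → let (a , b) = ∈-filter⁻ (λ x → T? (P x)) x∈ in gf (∈-perms⁻ n a) b)
      fg

  count-perms-bijection : ∀ (P Q : List ℕ → Bool) n m (f g : List ℕ → List ℕ) →
    (∀ {σ} → IsPerm n σ → T (P σ) → IsPerm m (f σ) × T (Q (f σ))) →
    (∀ {τ} → IsPerm m τ → T (Q τ) → IsPerm n (g τ) × T (P (g τ))) →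
    (∀ {σ} → IsPerm n σ → T (P σ) → g (f σ) ≡ σ) →
    (∀ {τ} → IsPerm m τ → T (Q τ) → f (g τ) ≡ τ) →
    count P (perms n) ≡ count Q (perms m)
  count-perms-bijection P Q n m f g fin gin gf fg =
    count-bijection P n (filter (λ x → T? (Q x)) (perms m)) f g (filter-Unique Q (perms-Unique m))
      (λ p t → let (a , b) = fin p t in ∈-filter⁺ (λ x → T? (Q x)) (∈-perms⁺ m a) b)
      (λ y∈ → let (a , b) = ∈-filter⁻ (λ x → T? (Q x)) y∈ in gin (∈-perms⁻ m a) b)
      gf
      (λ y∈ → let (a , b) = ∈-filter⁻ (λ x → T? (Q x)) y∈ in fg (∈-perms⁻ m a) b)

  shift : ℕ → List ℕ → List ℕ
  shift k = map (k +_)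

  1⊕_ : List ℕ → List ℕ
  1⊕ τ = 1 ∷ shift 1 τ

  startsWith1 : List ℕ → Bool
  startsWith1 [] = false
  startsWith1 (x ∷ _) = x ≡ᵇ 1

  positions-+ : ∀ i p → positions (i + p) ≡ positions i ++ shift i (positions p)
  positions-+ i zero rewrite +-identityʳ i = sym (++-identityʳ (positions i))
  positions-+ i (suc p) = begin
    positions (i + suc p) ≡⟨ cong positions (+-suc i p) ⟩
    positions (suc (i + p)) ≡⟨ positions-∷ʳ (i + p) ⟩
    positions (i + p) ++ [ suc (i + p) ] ≡⟨ cong (_++ [ suc (i + p) ]) (positions-+ i p) ⟩
    (positions i ++ shift i (positions p)) ++ [ suc (i + p) ] ≡⟨ ++-assoc (positions i) _ _ ⟩
    positions i ++ (shift i (positions p) ++ [ suc (i + p) ]) ≡⟨ cong (λ z → positions i ++ (shift i (positions p) ++ [ z ])) (sym (+-suc i p)) ⟩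
    positions i ++ (shift i (positions p) ++ shift i [ suc p ]) ≡⟨ cong (positions i ++_) (sym (map-++ (i +_) (positions p) [ suc p ])) ⟩
    positions i ++ shift i (positions p ++ [ suc p ]) ≡⟨ cong (λ z → positions i ++ shift i z) (sym (positions-∷ʳ p)) ⟩
    positions i ++ shift i (positions (suc p)) ∎
    where open ≡-Reasoning

  IsPerm-⊕ : ∀ {i p α β} → IsPerm i α → IsPerm p β → IsPerm (i + p) (α ++ shift i β)
  IsPerm-⊕ {i} {p} a b = subst (_ ↭_) (sym (positions-+ i p)) (PP.++⁺ a (PP.map⁺ (i +_) b))

  IsPerm-intro : ∀ n xs → length xs ≡ n → Unique xs → (∀ {x} → x ∈ xs → 1 ≤ x × x ≤ n) → IsPerm n xs
  IsPerm-intro zero [] _ _ _ = ↭-refl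
  IsPerm-intro (suc n) xs len u bounds with ∈-∃++ max∈xs
    where
    -- Otherwise xs would be a duplicate-free list of n + 1 numbers in 1 … n.
    max∈xs : suc n ∈ xs
    max∈xs with any? (suc n ≟_) xs
    ... | yes max∈ = max∈
    ... | no max∉ = ⊥-elim (1+n≰n (subst₂ _≤_ len (IsPerm⇒length {n} ↭-refl) (Unique-⊆⇒length≤ u below-max)))
      where
      below-max : ∀ {x} → x ∈ xs → x ∈ positions n
      below-max x∈ = let (1≤x , x≤1+n) = bounds x∈ in
        ∈-positions⁺ 1≤x (≤-pred (≤∧≢⇒< x≤1+n (λ { refl → max∉ x∈ })))
  ... | a , b , refl = IsPerm-insert n a b (IsPerm-intro n (a ++ b) len′ u′ bounds′)
    where
    distinct = Unique-++⁻ a u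
    max∉ : suc n ∉ a ++ b
    max∉ max∈ with ∈-++⁻ a max∈
    ... | inj₁ max∈a = proj₂ (proj₂ distinct) max∈a (here refl)
    ... | inj₂ max∈b = Unique-head (proj₁ (proj₂ distinct)) max∈b
    len′ : length (a ++ b) ≡ n
    len′ = suc-injective (trans (sym (length-++-∷ a (suc n) b)) len)
    u′ : Unique (a ++ b)
    u′ = UP.++⁺ (proj₁ distinct) (Unique-tail (proj₁ (proj₂ distinct)))
           (λ { (z∈a , z∈b) → proj₂ (proj₂ distinct) z∈a (there z∈b) })
    bounds′ : ∀ {x} → x ∈ a ++ b → 1 ≤ x × x ≤ n
    bounds′ x∈ = let (1≤x , x≤1+n) = bounds (∈-++-∷⁺ a b x∈) in
      1≤x , ≤-pred (≤∧≢⇒< x≤1+n (λ { refl → max∉ x∈ }))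

  IsPerm-prefix : ∀ {n} xs ys → IsPerm n (xs ++ ys) → (∀ {a b} → a ∈ xs → b ∈ ys → a < b) → IsPerm (length xs) xs
  IsPerm-prefix {n} xs ys p xs<ys =
    IsPerm-intro (length xs) xs refl (proj₁ (Unique-++⁻ xs (IsPerm⇒Unique p)))
                 (λ x∈ → proj₁ (IsPerm-bounds p (∈-++⁺ˡ x∈)) , bounded x∈)
    where
    -- 1 … x all lie in xs, because everything in ys exceeds x.
    bounded : ∀ {x} → x ∈ xs → x ≤ length xs
    bounded {x} x∈ = subst (_≤ length xs) (IsPerm⇒length {x} ↭-refl)
                           (Unique-⊆⇒length≤ (positions-unique x) below-x)
      where
      below-x : ∀ {v} → v ∈ positions x → v ∈ xs
      below-x v∈ with ∈-positions⁻ v∈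
      ... | 1≤v , v≤x with ∈-++⁻ xs (IsPerm-∋ p 1≤v (≤-trans v≤x (proj₂ (IsPerm-bounds p (∈-++⁺ˡ x∈)))))
      ... | inj₁ v∈xs = v∈xs
      ... | inj₂ v∈ys = ⊥-elim (<⇒≱ (xs<ys x∈ v∈ys) v≤x)

  IsPerm-suffix : ∀ {n} xs ys → IsPerm n (xs ++ ys) → IsPerm (length xs) xs →
    ∃ λ γ → ys ≡ shift (length xs) γ × IsPerm (n ∸ length xs) γ
  IsPerm-suffix {n} xs ys p xsP = γ , ys≡ , γP
    where
    j = length xs
    j<ys : ∀ {y} → y ∈ ys → j < y
    j<ys y∈ with j <? _
    ... | yes j<y = j<y
    ... | no j≮y = ⊥-elim (proj₂ (proj₂ (Unique-++⁻ xs (IsPerm⇒Unique p)))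
                    (PP.∈-resp-↭ (↭-sym xsP) (∈-positions⁺ (proj₁ (IsPerm-bounds p (∈-++⁺ʳ xs y∈))) (≮⇒≥ j≮y))) y∈)
    γ = map (_∸ j) ys
    ys≡ : ys ≡ shift j γ
    ys≡ = sym (trans (sym (map-∘ ys)) (map-id-local (All.tabulate (λ y∈ → m+[n∸m]≡n (<⇒≤ (j<ys y∈))))))
    length-ys : length ys ≡ n ∸ j
    length-ys = sym (trans (cong (_∸ j) (trans (sym (IsPerm⇒length p)) (length-++ xs))) (m+n∸m≡n j (length ys)))
    γP : IsPerm (n ∸ j) γ
    γP = IsPerm-intro (n ∸ j) γ (trans (length-map (_∸ j) ys) length-ys)
           (map-Unique (_∸ j) (proj₁ (proj₂ (Unique-++⁻ xs (IsPerm⇒Unique p))))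
                       (λ a∈ b∈ → ∸-cancelʳ-≡ (<⇒≤ (j<ys a∈)) (<⇒≤ (j<ys b∈))))
           γ-bounds
      where
      γ-bounds : ∀ {z} → z ∈ γ → 1 ≤ z × z ≤ n ∸ j
      γ-bounds z∈ with ∈-map⁻ (_∸ j) z∈
      ... | y , y∈ , refl = m<n⇒0<n∸m (j<ys y∈) , ∸-monoˡ-≤ j (proj₂ (IsPerm-bounds p (∈-++⁺ʳ xs y∈)))

  IsPerm-⊕⁻ : ∀ {n} xs ys → IsPerm n (xs ++ ys) → (∀ {a b} → a ∈ xs → b ∈ ys → a < b) →
    IsPerm (length xs) xs × ∃ λ γ → ys ≡ shift (length xs) γ × IsPerm (n ∸ length xs) γ
  IsPerm-⊕⁻ xs ys p xs<ys = let xsP = IsPerm-prefix xs ys p xs<ys in xsP , IsPerm-suffix xs ys p xsP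

  IsPerm-1⊕ : ∀ {m τ} → IsPerm m τ → IsPerm (suc m) (1⊕ τ)
  IsPerm-1⊕ {m} {τ} = IsPerm-⊕ {1} {m} {1 ∷ []} {τ} ↭-refl

module Separators where

  open Booleans
  open Lists
  open Permutations
  open import Data.Nat using (ℕ; _+_; _≤_; _<_; _<ᵇ_)
  open import Data.Nat.Properties using (+-assoc; +-cancelʳ-≡; ≤∧≢⇒<; <⇒≤; <-trans)
  open import Data.Bool using (Bool; true; false; _∧_; not; if_then_else_)
  open import Data.Bool.Properties using (∨-identityʳ)
  open import Data.Bool.ListAction using (any)
  open import Data.List using (List; []; _∷_; _++_; [_])
  open import Data.List.Properties using (++-assoc; ++-identityʳ; map-++)
  open import Data.List.Membership.Propositional using (_∈_)
  open import Data.List.Relation.Unary.Any using (here; there)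
  open import Data.Maybe using (Maybe; just; nothing)
  open import Data.Product using (∃₂; _×_; _,_; proj₁; proj₂)
  open import Data.List.Relation.Unary.Unique.Propositional using (Unique)
  open import Data.Empty using (⊥; ⊥-elim)
  open import Relation.Binary.PropositionalEquality using (_≡_; refl; sym; trans; cong; subst; module ≡-Reasoning)

  isSeparator : List ℕ → ℕ → List ℕ → Bool
  isSeparator pre x post = not (any (x <ᵇ_) pre) ∧ not (any (_<ᵇ x) post)

  separatorsAfter : List ℕ → List ℕ → ℕ
  separatorsAfter pre [] = 0
  separatorsAfter pre (x ∷ xs) = indicator (isSeparator pre x xs) + separatorsAfter (pre ++ [ x ]) xs

  separators : List ℕ → ℕ
  separators = separatorsAfter []

  Below : List ℕ → List ℕ → Set
  Below α δ = ∀ {a d} → a ∈ α → d ∈ δ → a ≤ d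

  Below-tailˡ : ∀ {y α δ} → Below (y ∷ α) δ → Below α δ
  Below-tailˡ h a∈ d∈ = h (there a∈) d∈

  Below-tailʳ : ∀ {y α δ} → Below α (y ∷ δ) → Below α δ
  Below-tailʳ h a∈ d∈ = h a∈ (there d∈)

  isSeparator-++-larger : ∀ pre y α δ → (∀ {d} → d ∈ δ → y ≤ d) → isSeparator pre y (α ++ δ) ≡ isSeparator pre y α
  isSeparator-++-larger pre y α δ h rewrite any-++ (_<ᵇ y) α δ
    | any-false⁺ {p = _<ᵇ y} δ (λ {d} d∈ → ≤⇒<ᵇ≡false d y (h d∈))
    | ∨-identityʳ (any (_<ᵇ y) α) = refl

  isSeparator-smaller-++ : ∀ α pre x post → (∀ {a} → a ∈ α → a ≤ x) → isSeparator (α ++ pre) x post ≡ isSeparator pre x post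
  isSeparator-smaller-++ α pre x post h rewrite any-++ (x <ᵇ_) α pre
    | any-false⁺ {p = x <ᵇ_} α (λ {a} a∈ → ≤⇒<ᵇ≡false x a (h a∈)) = refl

  separatorsAfter-++ : ∀ pre α δ → Below α δ → separatorsAfter pre (α ++ δ) ≡ separatorsAfter pre α + separatorsAfter (pre ++ α) δ
  separatorsAfter-++ pre [] δ h rewrite ++-identityʳ pre = refl
  separatorsAfter-++ pre (y ∷ α) δ h rewrite isSeparator-++-larger pre y α δ (h (here refl))
    | separatorsAfter-++ (pre ++ [ y ]) α δ (Below-tailˡ h)
    | ++-assoc pre [ y ] α = sym (+-assoc (indicator (isSeparator pre y α)) _ _)

  separatorsAfter-smaller-++ : ∀ α pre δ → Below α δ → separatorsAfter (α ++ pre) δ ≡ separatorsAfter pre δ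
  separatorsAfter-smaller-++ α pre [] h = refl
  separatorsAfter-smaller-++ α pre (x ∷ δ) h rewrite isSeparator-smaller-++ α pre x δ (λ a∈ → h a∈ (here refl))
    | ++-assoc α pre [ x ] = cong (indicator (isSeparator pre x δ) +_) (separatorsAfter-smaller-++ α (pre ++ [ x ]) δ (Below-tailʳ h))

  separators-++ : ∀ α δ → Below α δ → separators (α ++ δ) ≡ separators α + separators δ
  separators-++ α δ h = trans (separatorsAfter-++ [] α δ h)
    (cong (separators α +_) (trans (cong (λ z → separatorsAfter z δ) (sym (++-identityʳ α))) (separatorsAfter-smaller-++ α [] δ h)))

  isSeparator-shift : ∀ k pre x post → isSeparator (shift k pre) (k + x) (shift k post) ≡ isSeparator pre x post
  isSeparator-shift k pre x post rewrite any-map ((k + x) <ᵇ_) (k +_) pre | any-map (_<ᵇ (k + x)) (k +_) post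
    | any-cong {p = λ y → (k + x) <ᵇ (k + y)} {q = x <ᵇ_} pre (λ {y} _ → <ᵇ-+ˡ k x y)
    | any-cong {p = λ y → (k + y) <ᵇ (k + x)} {q = _<ᵇ x} post (λ {y} _ → <ᵇ-+ˡ k y x) = refl

  separatorsAfter-shift : ∀ k pre xs → separatorsAfter (shift k pre) (shift k xs) ≡ separatorsAfter pre xs
  separatorsAfter-shift k pre [] = refl
  separatorsAfter-shift k pre (x ∷ xs) rewrite isSeparator-shift k pre x xs
    | sym (map-++ (k +_) pre [ x ]) = cong (indicator (isSeparator pre x xs) +_) (separatorsAfter-shift k (pre ++ [ x ]) xs)

  separators-shift : ∀ k xs → separators (shift k xs) ≡ separators xs
  separators-shift k xs = separatorsAfter-shift k [] xs

  firstSeparator : List ℕ → List ℕ → Maybe (List ℕ × List ℕ)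
  firstSeparator pre [] = nothing
  firstSeparator pre (x ∷ xs) = if isSeparator pre x xs then just (pre , x ∷ xs) else firstSeparator (pre ++ [ x ]) xs

  firstSeparator-nothing : ∀ pre τ → firstSeparator pre τ ≡ nothing → separatorsAfter pre τ ≡ 0
  firstSeparator-nothing pre [] _ = refl
  firstSeparator-nothing pre (x ∷ xs) e with isSeparator pre x xs
  ... | true = ⊥-elim (jn≢ e)
    where jn≢ : ∀ {a : List ℕ × List ℕ} → just a ≡ nothing → ⊥
          jn≢ ()
  ... | false = firstSeparator-nothing (pre ++ [ x ]) xs e

  firstSeparator-just : ∀ pre τ {α r} → firstSeparator pre τ ≡ just (α , r) →
    (pre ++ τ ≡ α ++ r) × (separatorsAfter pre τ ≡ separatorsAfter α r) × ∃₂ λ x xs → r ≡ x ∷ xs × isSeparator α x xs ≡ true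
  firstSeparator-just pre [] ()
  firstSeparator-just pre (x ∷ xs) e with isSeparator pre x xs in eq
  firstSeparator-just pre (x ∷ xs) refl | true = refl , cong (λ b → indicator b + separatorsAfter (pre ++ [ x ]) xs) (sym eq) , x , xs , refl , eq
  ... | false with firstSeparator-just (pre ++ [ x ]) xs e
  ... | e1 , e2 , rest = trans (sym (++-assoc pre [ x ] xs)) e1 , e2 , rest

  firstSeparator-skip : ∀ pre α δ → separatorsAfter pre α ≡ 0 → Below α δ → firstSeparator pre (α ++ δ) ≡ firstSeparator (pre ++ α) δ
  firstSeparator-skip pre [] δ _ _ rewrite ++-identityʳ pre = refl
  firstSeparator-skip pre (y ∷ α) δ z h with indicator+≡0 (isSeparator pre y α) _ z
  ... | c0 , z' rewrite isSeparator-++-larger pre y α δ (h (here refl)) | c0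
    | firstSeparator-skip (pre ++ [ y ]) α δ z' (Below-tailˡ h) | ++-assoc pre [ y ] α = refl

  firstSeparator-split : ∀ τ {α r} → Unique τ → firstSeparator [] τ ≡ just (α , r) →
    ∃₂ λ x rest → τ ≡ α ++ x ∷ rest × (∀ {a} → a ∈ α → a < x) × (∀ {b} → b ∈ rest → x < b) × separators α ≡ 0
  firstSeparator-split τ {α} u e with firstSeparator-just [] τ e
  ... | τ≡ , separators≡ , x , rest , refl , x-separates = x , rest , τ≡ , α<x , x<rest , α-free
    where
    distinct = Unique-++⁻ α (subst Unique τ≡ u)
    sides = ∧≡true⁻ x-separates
    α<x : ∀ {a} → a ∈ α → a < x
    α<x a∈ = ≤∧≢⇒< (<ᵇ≡false⇒≥ x _ (any-false⁻ α (not≡true⁻ (proj₁ sides)) a∈))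
                   (λ { refl → proj₂ (proj₂ distinct) a∈ (here refl) })
    x<rest : ∀ {b} → b ∈ rest → x < b
    x<rest b∈ = ≤∧≢⇒< (<ᵇ≡false⇒≥ _ x (any-false⁻ rest (not≡true⁻ (proj₂ sides)) b∈))
                      (λ { refl → Unique-head (proj₁ (proj₂ distinct)) b∈ })
    α-below : Below α (x ∷ rest)
    α-below a∈ (here refl) = <⇒≤ (α<x a∈)
    α-below a∈ (there b∈) = <⇒≤ (<-trans (α<x a∈) (x<rest b∈))
    α-free : separators α ≡ 0
    α-free = +-cancelʳ-≡ (separators (x ∷ rest)) (separators α) 0 (begin
      separators α + separators (x ∷ rest)  ≡⟨ separators-++ α (x ∷ rest) α-below ⟨
      separators (α ++ x ∷ rest)            ≡⟨ cong separators τ≡ ⟨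
      separators τ                          ≡⟨ separators≡ ⟩
      separatorsAfter α (x ∷ rest)          ≡⟨ cong (λ w → separatorsAfter w (x ∷ rest)) (++-identityʳ α) ⟨
      separatorsAfter (α ++ []) (x ∷ rest)  ≡⟨ separatorsAfter-smaller-++ α [] (x ∷ rest) α-below ⟩
      separators (x ∷ rest)                 ∎)
      where open ≡-Reasoning

module Kings where

  open import Defs
  open Permutations
  open import Data.Nat using (ℕ; _<ᵇ_; ∣_-_∣)
  open import Data.Nat.Properties using (∣m+n-m+o∣≡∣n-o∣)
  open import Data.Bool using (Bool; true; _∧_)
  open import Data.Bool.Properties using (∧-assoc)
  open import Data.List using (List; []; _∷_; _++_)
  open import Relation.Binary.PropositionalEquality using (_≡_; refl; sym; cong; cong₂)

  kingJoin : List ℕ → List ℕ → Bool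
  kingJoin [] _ = true
  kingJoin (x ∷ []) [] = true
  kingJoin (x ∷ []) (y ∷ _) = 1 <ᵇ ∣ x - y ∣
  kingJoin (x ∷ x' ∷ xs) ys = kingJoin (x' ∷ xs) ys

  isKing-++ : ∀ xs ys → isKing (xs ++ ys) ≡ isKing xs ∧ (kingJoin xs ys ∧ isKing ys)
  isKing-++ [] ys = refl
  isKing-++ (x ∷ []) [] = refl
  isKing-++ (x ∷ []) (y ∷ ys) = refl
  isKing-++ (x ∷ x' ∷ xs) ys rewrite isKing-++ (x' ∷ xs) ys =
    sym (∧-assoc (1 <ᵇ ∣ x - x' ∣) (isKing (x' ∷ xs)) _)

  isKing-shift : ∀ k xs → isKing (shift k xs) ≡ isKing xs
  isKing-shift k [] = refl
  isKing-shift k (x ∷ []) = refl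
  isKing-shift k (x ∷ y ∷ xs) = cong₂ _∧_ (cong (1 <ᵇ_) (∣m+n-m+o∣≡∣n-o∣ k x y)) (isKing-shift k (y ∷ xs))

module Occurrences where

  open import Defs
  open Booleans
  open Lists
  open Permutations
  open Separators
  open import Data.Nat using (ℕ; zero; suc; pred; _+_; _∸_; _≤_; _<_; _>_; z≤n; s≤s; _<ᵇ_; _<?_)
  open import Data.Nat.Properties using (≤∧≢⇒<; +-identityʳ; <-cmp; <⇒≱; ≮⇒≥; ≤-trans)
  open import Relation.Nullary using (yes; no)
  open import Data.Bool using (Bool; true; false; _∧_; _∨_; not)
  open import Data.Bool.Properties using (∧-identityʳ; ∧-zeroʳ; T?)
  open import Data.Bool.ListAction using (any; all)
  open import Data.List using (List; []; _∷_; _++_; [_]; map; concatMap; filter; length; take; drop; upTo)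
  open import Data.List.Properties using (++-assoc; ++-identityʳ; length-++; length-map; take-[]; drop-[])
  open import Data.List.Membership.Propositional using (_∈_)
  open import Data.List.Membership.Propositional.Properties using (∈-++⁻; ∈-map⁻; ∈-upTo⁻)
  open import Data.List.Relation.Unary.Any using (here; there)
  open import Data.List.Relation.Unary.Unique.Propositional using (Unique)
  open import Data.Product using (_×_; _,_; proj₁; proj₂)
  open import Data.Sum using (inj₁; inj₂)
  open import Data.Empty using (⊥-elim)
  open import Relation.Binary.Definitions using (Tri; tri<; tri≈; tri>)
  open import Relation.Binary.PropositionalEquality using (_≡_; _≢_; refl; sym; trans; cong; cong₂; subst; module ≡-Reasoning)
  open import Function using (_∘_; case_of_)

  any-positions-slice : ∀ (σ : List ℕ) (P : ℕ → Bool) lo hi →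
    any (λ m → (lo <ᵇ m) ∧ (m <ᵇ hi) ∧ P (at σ m)) (positions (length σ)) ≡ any P (take (hi ∸ suc lo) (drop lo σ))
  any-positions-slice [] P lo hi = sym (cong (any P) (trans (cong (take (hi ∸ suc lo)) (drop-[] lo)) (take-[] (hi ∸ suc lo))))
  any-positions-slice (x ∷ xs) P lo hi =
    trans (cong (any F) (positions-suc (length xs)))
    (trans (cong (F 1 ∨_) (trans (any-map F suc (positions (length xs)))
             (trans (any-cong (positions (length xs)) shiftEq) (any-positions-slice xs P (pred lo) (pred hi)))))
     (final lo hi))
    where
    F : ℕ → Bool
    F m = (lo <ᵇ m) ∧ (m <ᵇ hi) ∧ P (at (x ∷ xs) m)
    G : ℕ → Bool
    G m = (pred lo <ᵇ m) ∧ (m <ᵇ pred hi) ∧ P (at xs m)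
    shiftEq : ∀ {m} → m ∈ positions (length xs) → F (suc m) ≡ G m
    shiftEq m∈ with ∈-map⁻ suc m∈
    ... | j , _ , refl = sh' lo hi j
      where
      sh' : ∀ lo hi j → ((lo <ᵇ suc (suc j)) ∧ (suc (suc j) <ᵇ hi) ∧ P (at xs (suc j))) ≡ ((pred lo <ᵇ suc j) ∧ (suc j <ᵇ pred hi) ∧ P (at xs (suc j)))
      sh' zero zero j = refl
      sh' zero (suc h) j = refl
      sh' (suc l) zero j = refl
      sh' (suc l) (suc h) j = refl
    final : ∀ lo hi → ((lo <ᵇ 1) ∧ (1 <ᵇ hi) ∧ P x) ∨ any P (take (pred hi ∸ suc (pred lo)) (drop (pred lo) xs))
                    ≡ any P (take (hi ∸ suc lo) (drop lo (x ∷ xs)))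
    final (suc l) zero = refl
    final (suc l) (suc h) = refl
    final zero zero = refl
    final zero (suc zero) = refl
    final zero (suc (suc h)) = refl

  noneBetween : ℕ → ℕ → List ℕ → Bool
  noneBetween lo hi l = not (any (λ v → (lo <ᵇ v) ∧ (v <ᵇ hi)) l)

  boxEmpty-slice : ∀ σ i₁ i₂ x y → boxEmpty σ i₁ i₂ (x , y) ≡
    noneBetween (sel3 0 (at σ i₁) (at σ i₂) y) (sel3 (at σ i₁) (at σ i₂) (suc (length σ)) y)
       (take (sel3 i₁ i₂ (suc (length σ)) x ∸ suc (sel3 0 i₁ i₂ x)) (drop (sel3 0 i₁ i₂ x) σ))
  boxEmpty-slice σ i₁ i₂ x y =
    cong not (any-positions-slice σ (λ v → (lo <ᵇ v) ∧ (v <ᵇ hi)) (sel3 0 i₁ i₂ x) (sel3 i₁ i₂ (suc (length σ)) x))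
    where
    lo = sel3 0 (at σ i₁) (at σ i₂) y
    hi = sel3 (at σ i₁) (at σ i₂) (suc (length σ)) y

  noneBetween-0-1 : ∀ l → noneBetween 0 1 l ≡ true
  noneBetween-0-1 [] = refl
  noneBetween-0-1 (zero ∷ l) = noneBetween-0-1 l
  noneBetween-0-1 (suc v ∷ l) = noneBetween-0-1 l

  noneBetween-false : ∀ lo hi l v → v ∈ l → lo < v → v < hi → noneBetween lo hi l ≡ false
  noneBetween-false lo hi l v v∈ a b = cong not (any-true⁺ {p = λ v → (lo <ᵇ v) ∧ (v <ᵇ hi)} v∈
    (cong₂ _∧_ (<⇒<ᵇ≡true lo v a) (<⇒<ᵇ≡true v hi b)))

  isOcc-shaded : ∀ R σ i₁ i₂ {b} → b ∈ R → boxEmpty σ i₁ i₂ b ≡ false → isOcc R σ i₁ i₂ ≡ false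
  isOcc-shaded R σ i₁ i₂ b∈R nonempty =
    trans (cong (λ z → (i₁ <ᵇ i₂) ∧ ((at σ i₁ <ᵇ at σ i₂) ∧ z)) (all-false⁺ b∈R nonempty))
          (trans (cong ((i₁ <ᵇ i₂) ∧_) (∧-zeroʳ _)) (∧-zeroʳ _))

  isOcc-descent : ∀ R σ i₁ i₂ → (at σ i₁ <ᵇ at σ i₂) ≡ false → isOcc R σ i₁ i₂ ≡ false
  isOcc-descent R σ i₁ i₂ descent =
    trans (cong (λ z → (i₁ <ᵇ i₂) ∧ (z ∧ all (boxEmpty σ i₁ i₂) R)) descent) (∧-zeroʳ _)

  R₀-boxes : ∀ (f : Box → Bool) → f (0 , 0) ≡ true → f (0 , 1) ≡ true → f (0 , 2) ≡ true → f (1 , 0) ≡ true → f (2 , 0) ≡ true →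
             all f R₀ ≡ f (1 , 2) ∧ f (2 , 1)
  R₀-boxes f e₀₀ e₀₁ e₀₂ e₁₀ e₂₀ rewrite e₀₀ | e₀₁ | e₀₂ | e₁₀ | e₂₀ = cong (f (1 , 2) ∧_) (∧-identityʳ _)

  -- The first entry x lies in the fully shaded column 0, whatever its value.
  no-occurrence-inner : ∀ x xs a b → Unique (x ∷ xs) → 1 ≤ x → x ≤ suc (length xs) → a < length xs → b < suc (length xs) →
    isOcc R₀ (x ∷ xs) (suc (suc a)) (suc b) ≡ false
  no-occurrence-inner x xs a zero u _ _ _ _ = refl
  no-occurrence-inner x xs a (suc b) u x≥1 x≤n a< (s≤s b<) = cases (<-cmp x v₁) (<-cmp x v₂)
    where
    σ = x ∷ xs
    i₁ = suc (suc a)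
    i₂ = suc (suc b)
    v₁ = at xs (suc a)
    v₂ = at xs (suc b)
    x-in-column-0 : ∀ y → (0 , y) ∈ R₀ → boxEmpty σ i₁ i₂ (0 , y) ≡ false → isOcc R₀ σ i₁ i₂ ≡ false
    x-in-column-0 y box∈R₀ = isOcc-shaded R₀ σ i₁ i₂ box∈R₀
    x≢ : ∀ {j} → j < length xs → x ≢ at xs (suc j)
    x≢ j< x≡ = Unique-head u (subst (_∈ xs) (sym x≡) (at-∈ xs _ j<))
    cases : Tri (x < v₁) (x ≡ v₁) (x > v₁) → Tri (x < v₂) (x ≡ v₂) (x > v₂) → isOcc R₀ σ i₁ i₂ ≡ false
    cases (tri< x<v₁ _ _) _ =
      x-in-column-0 0 (here refl) (trans (boxEmpty-slice σ i₁ i₂ 0 0) (noneBetween-false 0 v₁ (x ∷ take a xs) x (here refl) x≥1 x<v₁))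
    cases (tri≈ _ x≡v₁ _) _ = ⊥-elim (x≢ a< x≡v₁)
    cases (tri> _ _ x>v₁) (tri< x<v₂ _ _) =
      x-in-column-0 1 (there (here refl)) (trans (boxEmpty-slice σ i₁ i₂ 0 1) (noneBetween-false v₁ v₂ (x ∷ take a xs) x (here refl) x>v₁ x<v₂))
    cases (tri> _ _ _) (tri≈ _ x≡v₂ _) = ⊥-elim (x≢ b< x≡v₂)
    cases (tri> _ _ _) (tri> _ _ x>v₂) =
      x-in-column-0 2 (there (there (here refl)))
        (trans (boxEmpty-slice σ i₁ i₂ 0 2) (noneBetween-false v₂ _ (x ∷ take a xs) x (here refl) x>v₂ (s≤s x≤n)))

  -- With σ₁ ≠ 1, the entry 1 lies in the shaded row 0, left or right of σ_{i₂}.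
  no-occurrence-first : ∀ x xs b → 2 ≤ x → 1 ∈ xs → b < suc (length xs) →
    isOcc R₀ (x ∷ xs) 1 (suc b) ≡ false
  no-occurrence-first x xs zero _ _ _ = refl
  no-occurrence-first x xs (suc b) x≥2 1∈xs (s≤s b<) with x <? at xs (suc b)
  ... | no x≮v₂ = isOcc-descent R₀ (x ∷ xs) 1 (suc (suc b)) (≤⇒<ᵇ≡false x _ (≮⇒≥ x≮v₂))
  ... | yes x<v₂ with ∈-++⁻ (take b xs) (subst (1 ∈_) (at-split xs b b<) 1∈xs)
  ...   | inj₁ 1∈left = isOcc-shaded R₀ (x ∷ xs) 1 (suc (suc b)) (there (there (there (here refl))))
            (trans (boxEmpty-slice (x ∷ xs) 1 (suc (suc b)) 1 0) (noneBetween-false 0 x (take b xs) 1 1∈left (s≤s z≤n) x≥2))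
  ...   | inj₂ (here 1≡v₂) = ⊥-elim (<⇒≱ x<v₂ (subst (_≤ x) 1≡v₂ (≤-trans (s≤s z≤n) x≥2)))
  ...   | inj₂ (there 1∈right) = isOcc-shaded R₀ (x ∷ xs) 1 (suc (suc b)) (there (there (there (there (there (here refl))))))
            (trans (boxEmpty-slice (x ∷ xs) 1 (suc (suc b)) 2 0) (noneBetween-false 0 x _ 1
               (subst (1 ∈_) (sym (take-all-drop xs (suc b))) 1∈right) (s≤s z≤n) x≥2))

  -- For σ = 1 ∷ xs only the boxes (1,2) and (2,1) are not trivially empty,
  -- and they say that σ_{i₂} separates the entries of xs before and after it.
  occurrence-1∷ : ∀ xs b → (∀ {v} → v ∈ xs → 2 ≤ v × v ≤ suc (length xs)) → b < length xs →
    isOcc R₀ (1 ∷ xs) 1 (suc (suc b)) ≡ isSeparator (take b xs) (at xs (suc b)) (drop (suc b) xs)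
  occurrence-1∷ xs b bounds b< =
    trans (cong (λ c → c ∧ all (boxEmpty σ 1 i₂) R₀) (<⇒<ᵇ≡true 1 v₂ (proj₁ (bounds (at-∈ xs b b<)))))
    (trans (R₀-boxes (boxEmpty σ 1 i₂) (boxEmpty-slice σ 1 i₂ 0 0) (boxEmpty-slice σ 1 i₂ 0 1) (boxEmpty-slice σ 1 i₂ 0 2)
                     (trans (boxEmpty-slice σ 1 i₂ 1 0) (noneBetween-0-1 (take b xs)))
                     (trans (boxEmpty-slice σ 1 i₂ 2 0) (noneBetween-0-1 (take (length xs ∸ suc b) (drop (suc b) xs)))))
           (cong₂ _∧_ (trans (boxEmpty-slice σ 1 i₂ 1 2) (cong not larger-before))
                      (trans (boxEmpty-slice σ 1 i₂ 2 1) (cong not smaller-after))))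
    where
    σ = 1 ∷ xs
    i₂ = suc (suc b)
    v₂ = at xs (suc b)
    larger-before : any (λ v → (v₂ <ᵇ v) ∧ (v <ᵇ suc (suc (length xs)))) (take b xs) ≡ any (v₂ <ᵇ_) (take b xs)
    larger-before = any-cong (take b xs) (λ {v} v∈ →
      trans (cong ((v₂ <ᵇ v) ∧_) (<⇒<ᵇ≡true v _ (s≤s (proj₂ (bounds (∈-take b xs v∈)))))) (∧-identityʳ _))
    smaller-after : any (λ v → (1 <ᵇ v) ∧ (v <ᵇ v₂)) (take (length xs ∸ suc b) (drop (suc b) xs)) ≡ any (_<ᵇ v₂) (drop (suc b) xs)
    smaller-after = trans (cong (any (λ v → (1 <ᵇ v) ∧ (v <ᵇ v₂))) (take-all-drop xs (suc b)))
      (any-cong (drop (suc b) xs) (λ {v} v∈ → cong (_∧ (v <ᵇ v₂)) (<⇒<ᵇ≡true 1 v (proj₁ (bounds (∈-drop (suc b) xs v∈))))))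

  countBy-separatorsAfter : ∀ pre l → countBy (λ c → isSeparator (pre ++ take c l) (at l (suc c)) (drop (suc c) l)) (upTo (length l)) ≡ separatorsAfter pre l
  countBy-separatorsAfter pre [] = refl
  countBy-separatorsAfter pre (x ∷ xs) =
    trans (cong (countBy f) (upTo-suc (length xs)))
    (cong₂ _+_ (cong (λ z → indicator (isSeparator z x xs)) (++-identityʳ pre))
       (trans (countBy-map f suc (upTo (length xs)))
         (trans (countBy-cong (upTo (length xs)) (λ {c} _ → cong (λ z → isSeparator z (at xs (suc c)) (drop (suc c) xs)) (sym (++-assoc pre [ x ] (take c xs)))))
            (countBy-separatorsAfter (pre ++ [ x ]) xs))))
    where
    f : ℕ → Bool
    f c = isSeparator (pre ++ take c (x ∷ xs)) (at (x ∷ xs) (suc c)) (drop (suc c) (x ∷ xs))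

  occurrences-start-at-1 : ∀ {n} x xs → IsPerm n (x ∷ xs) →
    occurrences R₀ (x ∷ xs) ≡ countBy (isOcc R₀ (x ∷ xs) 1) (positions (suc (length xs)))
  occurrences-start-at-1 {n} x xs p =
    trans (cong (λ l → length (concatMap g l)) (positions-suc L))
    (trans (length-++ (g 1))
    (trans (cong₂ _+_ (length-filter≡countBy (isOcc R₀ σ 1) ps) (length-concatMap-empty g (map suc (positions L)) no-later-start))
     (+-identityʳ _)))
    where
    σ = x ∷ xs
    L = length xs
    ps = positions (suc L)
    g : ℕ → List ℕ
    g i₁ = filter (λ i₂ → T? (isOcc R₀ σ i₁ i₂)) ps
    u = IsPerm⇒Unique p
    length≡ : suc L ≡ n
    length≡ = IsPerm⇒length p
    x-bounds : 1 ≤ x × x ≤ suc L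
    x-bounds = subst (λ z → 1 ≤ x × x ≤ z) (sym length≡) (IsPerm-bounds p (here refl))
    no-later-start : ∀ {m} → m ∈ map suc (positions L) → length (g m) ≡ 0
    no-later-start m∈ with ∈-map⁻ suc m∈
    ... | m' , m'∈ , refl with ∈-map⁻ suc m'∈
    ... | a , a∈ , refl = trans (length-filter≡countBy (isOcc R₀ σ (suc (suc a))) ps)
          (countBy-false ps no-occurrence)
      where
      no-occurrence : ∀ {i₂} → i₂ ∈ ps → isOcc R₀ σ (suc (suc a)) i₂ ≡ false
      no-occurrence i₂∈ with ∈-map⁻ suc i₂∈
      ... | b , b∈ , refl = no-occurrence-inner x xs a b u (proj₁ x-bounds) (proj₂ x-bounds) (∈-upTo⁻ a∈) (∈-upTo⁻ b∈)

  occurrences-not-startsWith1 : ∀ {n} σ → IsPerm n σ → startsWith1 σ ≡ false → occurrences R₀ σ ≡ 0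
  occurrences-not-startsWith1 [] p _ = refl
  occurrences-not-startsWith1 {n} (x ∷ xs) p x≢ᵇ1 =
    trans (occurrences-start-at-1 x xs p) (countBy-false (positions (suc (length xs))) no-occurrence)
    where
    x≢1 : x ≢ 1
    x≢1 refl = case x≢ᵇ1 of λ ()
    x≥2 : 2 ≤ x
    x≥2 = ≤∧≢⇒< (proj₁ (IsPerm-bounds p (here refl))) (x≢1 ∘ sym)
    1∈xs : 1 ∈ xs
    1∈xs with IsPerm-∋ p (s≤s z≤n) (subst (1 ≤_) (IsPerm⇒length p) (s≤s z≤n))
    ... | here 1≡x = ⊥-elim (x≢1 (sym 1≡x))
    ... | there 1∈ = 1∈
    no-occurrence : ∀ {i₂} → i₂ ∈ positions (suc (length xs)) → isOcc R₀ (x ∷ xs) 1 i₂ ≡ false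
    no-occurrence i₂∈ with ∈-map⁻ suc i₂∈
    ... | b , b∈ , refl = no-occurrence-first x xs b x≥2 1∈xs (∈-upTo⁻ b∈)

  occurrences-1⊕ : ∀ {n} τ → IsPerm n τ → occurrences R₀ (1⊕ τ) ≡ separators τ
  occurrences-1⊕ {n} τ p = begin
    occurrences R₀ σ
      ≡⟨ occurrences-start-at-1 1 xs (IsPerm-1⊕ p) ⟩
    countBy (isOcc R₀ σ 1) (positions (suc L))
      ≡⟨ cong (countBy (isOcc R₀ σ 1)) (positions-suc L) ⟩
    countBy (isOcc R₀ σ 1) (1 ∷ map suc (positions L))
      ≡⟨ countBy-map (isOcc R₀ σ 1) suc (positions L) ⟩
    countBy (isOcc R₀ σ 1 ∘ suc) (map suc (upTo L))
      ≡⟨ countBy-map (isOcc R₀ σ 1 ∘ suc) suc (upTo L) ⟩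
    countBy (isOcc R₀ σ 1 ∘ suc ∘ suc) (upTo L)
      ≡⟨ countBy-cong (upTo L) (λ {b} b∈ → occurrence-1∷ xs b bounds (∈-upTo⁻ b∈)) ⟩
    countBy (λ c → isSeparator (take c xs) (at xs (suc c)) (drop (suc c) xs)) (upTo L)
      ≡⟨ countBy-separatorsAfter [] xs ⟩
    separators xs
      ≡⟨ separators-shift 1 τ ⟩
    separators τ ∎
    where
    open ≡-Reasoning
    xs = shift 1 τ
    σ = 1 ∷ xs
    L = length xs
    bounds : ∀ {v} → v ∈ xs → 2 ≤ v × v ≤ suc L
    bounds v∈ with ∈-map⁻ (1 +_) v∈
    ... | t , t∈ , refl with IsPerm-bounds p t∈
    ... | 1≤t , t≤n = s≤s 1≤t , s≤s (subst (_ ≤_) (sym (trans (length-map (1 +_) τ) (IsPerm⇒length p))) t≤n)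

module FirstLetter where

  open import Defs
  open Booleans
  open Lists
  open Permutations
  open Separators
  open Kings
  open Occurrences
  open import Data.Nat using (ℕ; zero; suc; pred; _+_; _<_; _≡ᵇ_)
  open import Data.Nat.Properties using (+-comm; ≡ᵇ⇒≡; ≤∧≢⇒<)
  open import Data.Bool using (Bool; true; false; _∧_; not; T)
  open import Data.Bool.Properties using (∧-identityʳ; ∧-zeroʳ)
  open import Data.List using (List; []; _∷_; map; drop)
  open import Data.List.Membership.Propositional using (_∈_)
  open import Data.List.Relation.Unary.Any using (here; there)
  open import Data.Product using (_×_; _,_; proj₁)
  open import Function using (_∘_)
  open import Relation.Binary.PropositionalEquality using (_≡_; refl; sym; trans; cong; cong₂; subst; module ≡-Reasoning)

  strip1 : List ℕ → List ℕ
  strip1 σ = map pred (drop 1 σ)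

  map-pred-shift1 : ∀ τ → map pred (shift 1 τ) ≡ τ
  map-pred-shift1 [] = refl
  map-pred-shift1 (x ∷ τ) = cong (x ∷_) (map-pred-shift1 τ)

  startsWith1⇒1⊕ : ∀ {m} σ → IsPerm (suc m) σ → T (startsWith1 σ) → σ ≡ 1⊕ strip1 σ × IsPerm m (strip1 σ)
  startsWith1⇒1⊕ (x ∷ xs) p t with ≡ᵇ⇒≡ x 1 t
  ... | refl with IsPerm-⊕⁻ (1 ∷ []) xs p (λ { (here refl) b∈ → 1<b b∈ })
    where
    1<b : ∀ {b} → b ∈ xs → 1 < b
    1<b b∈ = ≤∧≢⇒< (proj₁ (IsPerm-bounds p (there b∈))) (λ { refl → Unique-head (IsPerm⇒Unique p) b∈ })
  ... | _ , γ , refl , γp = cong 1⊕_ (sym (map-pred-shift1 γ)) , subst (IsPerm _) (sym (map-pred-shift1 γ)) γp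

  count-startsWith1 : ∀ m (R : List ℕ → Bool) →
    count (λ σ → R σ ∧ startsWith1 σ) (perms (suc m)) ≡ count (R ∘ 1⊕_) (perms m)
  count-startsWith1 m R = count-perms-bijection (λ σ → R σ ∧ startsWith1 σ) (R ∘ 1⊕_) (suc m) m strip1 1⊕_
    (λ {σ} p t → let (e , q) = startsWith1⇒1⊕ σ p (T-∧⁻ʳ t) in q , subst (T ∘ R) e (T-∧⁻ˡ t))
    (λ {τ} p t → IsPerm-1⊕ p , subst T (sym (∧-identityʳ (R (1⊕ τ)))) t)
    (λ {σ} p t → sym (proj₁ (startsWith1⇒1⊕ σ p (T-∧⁻ʳ {R σ} t))))
    (λ {τ} _ _ → map-pred-shift1 τ)

  isNonOneKing : List ℕ → Bool
  isNonOneKing σ = isKing σ ∧ not (startsWith1 σ)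

  isKing-1⊕ : ∀ {m} τ → IsPerm m τ → isKing (1⊕ τ) ≡ isNonOneKing τ
  isKing-1⊕ [] p = refl
  isKing-1⊕ (t ∷ τ) p with IsPerm-bounds p (here refl)
  ... | t≥1 , _ with t
  ...   | suc zero = sym (∧-zeroʳ (isKing (1 ∷ τ)))
  ...   | suc (suc t′) = trans (isKing-shift 1 (suc (suc t′) ∷ τ)) (sym (∧-identityʳ _))

  nonOneKings : ℕ → ℕ
  nonOneKings n = count isNonOneKing (perms n)

  nonOneKingsWith : ℕ → ℕ → ℕ
  nonOneKingsWith n k = count (λ σ → isNonOneKing σ ∧ (separators σ ≡ᵇ k)) (perms n)

  kings-by-first-letter : ∀ m → count isKing (perms (suc m)) ≡ nonOneKings (suc m) + nonOneKings m
  kings-by-first-letter m = begin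
    count isKing (perms (suc m))
      ≡⟨ count-split isKing startsWith1 (perms (suc m)) ⟩
    count (λ σ → isKing σ ∧ startsWith1 σ) (perms (suc m)) + nonOneKings (suc m)
      ≡⟨ +-comm _ (nonOneKings (suc m)) ⟩
    nonOneKings (suc m) + count (λ σ → isKing σ ∧ startsWith1 σ) (perms (suc m))
      ≡⟨ cong (nonOneKings (suc m) +_) (count-startsWith1 m isKing) ⟩
    nonOneKings (suc m) + count (isKing ∘ 1⊕_) (perms m)
      ≡⟨ cong (nonOneKings (suc m) +_) (count-perms-cong _ _ m (λ {τ} → isKing-1⊕ τ)) ⟩
    nonOneKings (suc m) + nonOneKings m ∎
    where open ≡-Reasoning

  isKingWith : ℕ → List ℕ → Bool
  isKingWith k σ = isKing σ ∧ (occurrences R₀ σ ≡ᵇ k)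

  kingsWith-startsWith1 : ∀ m k →
    count (λ σ → isKingWith k σ ∧ startsWith1 σ) (perms (suc m)) ≡ nonOneKingsWith m k
  kingsWith-startsWith1 m k = trans (count-startsWith1 m (isKingWith k))
    (count-perms-cong _ _ m (λ {τ} p → cong₂ _∧_ (isKing-1⊕ τ p) (cong (_≡ᵇ k) (occurrences-1⊕ τ p))))

  kingsWith-not-startsWith1 : ∀ n k →
    count (λ σ → isKingWith k σ ∧ not (startsWith1 σ)) (perms n) ≡ count (λ σ → isNonOneKing σ ∧ (0 ≡ᵇ k)) (perms n)
  kingsWith-not-startsWith1 n k = count-perms-cong _ _ n reorder
    where
    reorder : ∀ {σ} → IsPerm n σ → isKingWith k σ ∧ not (startsWith1 σ) ≡ isNonOneKing σ ∧ (0 ≡ᵇ k)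
    reorder {σ} p with startsWith1 σ in s
    ... | true = trans (∧-zeroʳ _) (sym (cong (_∧ (0 ≡ᵇ k)) (∧-zeroʳ (isKing σ))))
    ... | false rewrite occurrences-not-startsWith1 σ p s =
      trans (∧-identityʳ _) (cong (_∧ (0 ≡ᵇ k)) (sym (∧-identityʳ (isKing σ))))

module FirstSeparator where

  open import Defs
  open Booleans
  open Lists
  open Permutations
  open Separators
  open Kings
  open FirstLetter
  open import Data.Nat using (ℕ; zero; suc; pred; _+_; _*_; _∸_; _≤_; _<_; z≤n; s≤s; _<ᵇ_; _≡ᵇ_; ∣_-_∣)
  open import Data.Nat.Properties using (+-comm; +-monoʳ-≤; +-cancelˡ-<; <⇒≤; <⇒≱; <-trans; m+n∸m≡n; m≤m+n; ≤-trans; ≤∧≢⇒<; ≡ᵇ⇒≡; m+[n∸m]≡n; m∸n≢0⇒n<m; 1+n≢0)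
  open import Data.Bool using (Bool; true; false; _∧_; not; T)
  open import Data.Bool.Properties using (∧-assoc; ∧-identityʳ; ∧-zeroʳ; T?)
  open import Data.List using (List; []; _∷_; _++_; [_]; map; concatMap; filter; length; drop; null; upTo; cartesianProduct)
  open import Data.Nat.ListAction using (sum)
  open import Data.List.Properties using (length-map; map-cong; map-∘; ∷-injective; map-id-local)
  open import Data.List.Membership.Propositional using (_∈_)
  open import Data.List.Membership.Propositional.Properties using (∈-++⁺ʳ; ∈-++⁺ˡ; ∈-cartesianProduct⁺; ∈-cartesianProduct⁻; ∈-concat⁺′; ∈-concat⁻′; ∈-filter⁺; ∈-filter⁻; ∈-map⁺; ∈-map⁻; ∈-upTo⁺)
  open import Data.List.Relation.Unary.Any using (here; there)
  import Data.List.Relation.Unary.All as All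
  open import Data.List.Relation.Unary.AllPairs using ([])
  open import Data.List.Relation.Unary.Unique.Propositional using (Unique)
  import Data.List.Relation.Unary.Unique.Propositional.Properties as UP
  open import Data.Maybe using (Maybe; just; nothing)
  open import Data.Product using (∃; ∃₂; _×_; _,_; proj₁; proj₂)
  open import Data.Empty using (⊥-elim)
  open import Function using (_∘_)
  open import Relation.Binary.PropositionalEquality using (_≡_; _≢_; refl; sym; trans; cong; cong₂; subst; module ≡-Reasoning)

  isIndecomposableKing : List ℕ → Bool
  isIndecomposableKing α = not (null α) ∧ (isKing α ∧ (separators α ≡ᵇ 0))

  glue : ℕ × List ℕ × List ℕ → List ℕ
  glue (i , α , β) = α ++ shift i (1⊕ β)

  Below-shift : ∀ {i α} γ → IsPerm i α → Below α (shift i γ)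
  Below-shift {i} γ p a∈ d∈ with ∈-map⁻ (i +_) d∈
  ... | d , _ , refl = ≤-trans (proj₂ (IsPerm-bounds p a∈)) (m≤m+n i d)

  separators-1⊕ : ∀ β → separators (1⊕ β) ≡ suc (separators β)
  separators-1⊕ β = trans (separators-++ [ 1 ] (shift 1 β) 1-below) (cong suc (separators-shift 1 β))
    where
    1-below : Below [ 1 ] (shift 1 β)
    1-below (here refl) d∈ with ∈-map⁻ (1 +_) d∈
    ... | _ , _ , refl = s≤s z≤n

  separators-glue : ∀ {i α} β → IsPerm i α → separators α ≡ 0 → separators (glue (i , α , β)) ≡ suc (separators β)
  separators-glue {i} {α} β p α-free = begin
    separators (α ++ shift i (1⊕ β))           ≡⟨ separators-++ α _ (Below-shift (1⊕ β) p) ⟩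
    separators α + separators (shift i (1⊕ β)) ≡⟨ cong₂ _+_ α-free (separators-shift i (1⊕ β)) ⟩
    separators (1⊕ β)                          ≡⟨ separators-1⊕ β ⟩
    suc (separators β)                         ∎
    where open ≡-Reasoning

  IsPerm-glue : ∀ {i p α β} → IsPerm i α → IsPerm p β → IsPerm (i + suc p) (glue (i , α , β))
  IsPerm-glue αP βP = IsPerm-⊕ αP (IsPerm-1⊕ βP)

  separators-1∷≢0 : ∀ {i} α → IsPerm i (1 ∷ α) → separators (1 ∷ α) ≢ 0
  separators-1∷≢0 α p = 1+n≢0 ∘ trans (cong (λ b → indicator b + separatorsAfter [ 1 ] α) (sym 1-separates))
    where
    1-separates : isSeparator [] 1 α ≡ true
    1-separates = cong not (any-false⁺ α (λ v∈ → ≤⇒<ᵇ≡false _ 1 (proj₁ (IsPerm-bounds p (there v∈)))))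

  -- A maximal last entry would be a separator.
  last<max : ∀ {i} α l → IsPerm i (α ++ [ l ]) → separators (α ++ [ l ]) ≡ 0 → l < i
  last<max {i} α l p α-free = ≤∧≢⇒< (proj₂ (IsPerm-bounds p (∈-++⁺ʳ α (here refl)))) l≢i
    where
    l≢i : l ≢ i
    l≢i refl = 1+n≢0 (trans (+-comm 1 (separators α)) (trans (sym (separators-++ α [ l ] α-below)) α-free))
      where
      α-below : Below α [ l ]
      α-below a∈ (here refl) = proj₂ (IsPerm-bounds p (∈-++⁺ˡ a∈))

  kingJoin-snoc : ∀ α l y r → kingJoin (α ++ [ l ]) (y ∷ r) ≡ (1 <ᵇ ∣ l - y ∣)
  kingJoin-snoc [] l y r = refl
  kingJoin-snoc (a ∷ []) l y r = refl
  kingJoin-snoc (a ∷ b ∷ α) l y r = kingJoin-snoc (b ∷ α) l y r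

  1<∣l-1+i∣ : ∀ {l i} → l < i → 1 < ∣ l - suc i ∣
  1<∣l-1+i∣ {zero} {suc i} _ = s≤s (s≤s z≤n)
  1<∣l-1+i∣ {suc l} {suc i} (s≤s l<i) = 1<∣l-1+i∣ l<i

  kingJoin-glue : ∀ {i} α r → IsPerm i α → separators α ≡ 0 → kingJoin α ((i + 1) ∷ r) ≡ true
  kingJoin-glue [] r _ _ = refl
  kingJoin-glue {i} (a ∷ α) r p α-free with snoc-view a α
  ... | α′ , l , a∷α≡ = begin
    kingJoin (a ∷ α) ((i + 1) ∷ r)       ≡⟨ cong (λ w → kingJoin w ((i + 1) ∷ r)) a∷α≡ ⟩
    kingJoin (α′ ++ [ l ]) ((i + 1) ∷ r) ≡⟨ kingJoin-snoc α′ l (i + 1) r ⟩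
    (1 <ᵇ ∣ l - (i + 1) ∣)               ≡⟨ <⇒<ᵇ≡true 1 _ (subst (λ j → 1 < ∣ l - j ∣) (+-comm 1 i) (1<∣l-1+i∣ l<i)) ⟩
    true                                 ∎
    where
    open ≡-Reasoning
    l<i = last<max α′ l (subst (IsPerm i) a∷α≡ p) (trans (cong separators (sym a∷α≡)) α-free)

  isKing-glue : ∀ {i p α β} → IsPerm i α → separators α ≡ 0 → IsPerm p β →
                isKing (glue (i , α , β)) ≡ isKing α ∧ isNonOneKing β
  isKing-glue {i} {p} {α} {β} αP α-free βP = begin
    isKing (α ++ shift i (1⊕ β))
      ≡⟨ isKing-++ α _ ⟩
    isKing α ∧ (kingJoin α (shift i (1⊕ β)) ∧ isKing (shift i (1⊕ β)))
      ≡⟨ cong (isKing α ∧_) (cong₂ _∧_ (kingJoin-glue α _ αP α-free) (trans (isKing-shift i (1⊕ β)) (isKing-1⊕ β βP))) ⟩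
    isKing α ∧ isNonOneKing β ∎
    where open ≡-Reasoning

  startsWith1-glue : ∀ {i α} β → IsPerm i α → separators α ≡ 0 → startsWith1 (glue (i , α , β)) ≡ null α
  startsWith1-glue {i} {[]} β p _ with IsPerm⇒length p
  ... | refl = refl
  startsWith1-glue {i} {a ∷ α} β p α-free with a ≡ᵇ 1 in a≡ᵇ1
  ... | false = refl
  ... | true with ≡ᵇ⇒≡ a 1 (≡true⇒T a≡ᵇ1)
  ...   | refl = ⊥-elim (separators-1∷≢0 α p α-free)

  isNonOneKing-glue : ∀ {i p α β} → IsPerm i α → separators α ≡ 0 → IsPerm p β →
                      isNonOneKing (glue (i , α , β)) ≡ isIndecomposableKing α ∧ isNonOneKing β
  isNonOneKing-glue {i} {p} {α} {β} αP α-free βP = begin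
    isKing (glue (i , α , β)) ∧ not (startsWith1 (glue (i , α , β)))
      ≡⟨ cong₂ (λ a b → a ∧ not b) (isKing-glue αP α-free βP) (startsWith1-glue β αP α-free) ⟩
    (isKing α ∧ isNonOneKing β) ∧ not (null α)
      ≡⟨ ∧-rearrange (isKing α) (isNonOneKing β) (not (null α)) ⟩
    (not (null α) ∧ (isKing α ∧ true)) ∧ isNonOneKing β
      ≡⟨ cong (λ s → (not (null α) ∧ (isKing α ∧ (s ≡ᵇ 0))) ∧ isNonOneKing β) α-free ⟨
    isIndecomposableKing α ∧ isNonOneKing β ∎
    where open ≡-Reasoning

  cutAt : Maybe (List ℕ × List ℕ) → ℕ × List ℕ × List ℕ
  cutAt nothing = 0 , [] , []
  cutAt (just (α , r)) = length α , α , map pred (drop 1 (map (_∸ length α) r))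

  cut : List ℕ → ℕ × List ℕ × List ℕ
  cut τ = cutAt (firstSeparator [] τ)

  isSeparator-glue : ∀ {i α} β → IsPerm i α → isSeparator α (i + 1) (shift i (shift 1 β)) ≡ true
  isSeparator-glue {i} {α} β p = cong₂ (λ u v → not u ∧ not v)
    (any-false⁺ α (λ a∈ → ≤⇒<ᵇ≡false (i + 1) _ (≤-trans (proj₂ (IsPerm-bounds p a∈)) (m≤m+n i 1))))
    (any-false⁺ (shift i (shift 1 β)) above)
    where
    above : ∀ {d} → d ∈ shift i (shift 1 β) → (d <ᵇ (i + 1)) ≡ false
    above d∈ with ∈-map⁻ (i +_) d∈
    ... | e , e∈ , refl with ∈-map⁻ (1 +_) e∈
    ... | b , _ , refl = ≤⇒<ᵇ≡false (i + suc b) (i + 1) (+-monoʳ-≤ i (s≤s z≤n))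

  strip-shift-1⊕ : ∀ i β → map pred (drop 1 (map (_∸ i) (shift i (1⊕ β)))) ≡ β
  strip-shift-1⊕ i β =
    trans (cong (map pred) (trans (sym (map-∘ (shift 1 β))) (map-id-local (All.tabulate (λ _ → m+n∸m≡n i _)))))
          (map-pred-shift1 β)

  cut-glue : ∀ {i α} β → IsPerm i α → separators α ≡ 0 → cut (glue (i , α , β)) ≡ (i , α , β)
  cut-glue {i} {α} β p α-free =
    trans (cong cutAt (trans (firstSeparator-skip [] α _ α-free (Below-shift (1⊕ β) p)) separator-at-1⊕))
          (cong₂ _,_ (IsPerm⇒length p) (cong (α ,_) (subst (λ j → unshift j ≡ β) (sym (IsPerm⇒length p)) (strip-shift-1⊕ i β))))
    where
    unshift : ℕ → List ℕ
    unshift j = map pred (drop 1 (map (_∸ j) (shift i (1⊕ β))))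
    separator-at-1⊕ : firstSeparator α (shift i (1⊕ β)) ≡ just (α , shift i (1⊕ β))
    separator-at-1⊕ rewrite isSeparator-glue β p = refl

  head-minimal≡1 : ∀ {m g γ} → IsPerm m (g ∷ γ) → (∀ {b} → b ∈ γ → g < b) → g ≡ 1
  head-minimal≡1 p g<γ with IsPerm-∋ p (s≤s z≤n) (subst (1 ≤_) (IsPerm⇒length p) (s≤s z≤n))
  ... | here 1≡g = sym 1≡g
  ... | there 1∈γ = ⊥-elim (<⇒≱ (g<γ 1∈γ) (proj₁ (IsPerm-bounds p (here refl))))

  -- Splitting τ = α ++ x ∷ rest at its first separator x, the entries of
  -- x ∷ rest are exactly i + 1, …, n (i = |α|), and x is the smallest of them.
  glue-split : ∀ {n} τ {α r} → IsPerm n τ → firstSeparator [] τ ≡ just (α , r) →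
    ∃₂ λ p β → τ ≡ glue (length α , α , β) × IsPerm (length α) α × IsPerm p β × length α + suc p ≡ n × separators α ≡ 0
  glue-split {n} τ {α} pτ e with firstSeparator-split τ (IsPerm⇒Unique pτ) e
  ... | x , rest , τ≡ , α<x , x<rest , α-free with IsPerm-⊕⁻ α (x ∷ rest) (subst (IsPerm n) τ≡ pτ) α<x∷rest
    where
    α<x∷rest : ∀ {a b} → a ∈ α → b ∈ x ∷ rest → a < b
    α<x∷rest a∈ (here refl) = α<x a∈
    α<x∷rest a∈ (there b∈) = <-trans (α<x a∈) (x<rest b∈)
  ... | αP , g ∷ γ , x∷rest≡ , γP with ∷-injective x∷rest≡
  ... | refl , refl with head-minimal≡1 γP (λ b∈ → +-cancelˡ-< (length α) _ _ (x<rest (∈-map⁺ (length α +_) b∈)))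
  ... | refl with startsWith1⇒1⊕ (1 ∷ γ) (subst (λ k → IsPerm k (1 ∷ γ)) (sym (IsPerm⇒length γP)) γP) _
  ... | 1∷γ≡ , βP = length γ , map pred γ , trans τ≡ (cong (λ δ → α ++ shift (length α) δ) 1∷γ≡) , αP , βP , size , α-free
    where
    size : length α + suc (length γ) ≡ n
    size = trans (cong (length α +_) (IsPerm⇒length γP)) (m+[n∸m]≡n (<⇒≤ (m∸n≢0⇒n<m {n} {length α} (λ n∸i≡0 → 1+n≢0 (trans (IsPerm⇒length γP) n∸i≡0)))))

  onPred : (ℕ → Bool) → ℕ → Bool
  onPred Q zero = false
  onPred Q (suc s) = Q s

  module Gluing (Q : ℕ → Bool) where

    isTailKing : List ℕ → Bool
    isTailKing β = isNonOneKing β ∧ Q (separators β)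

    isSeparatedKing : List ℕ → Bool
    isSeparatedKing τ = isNonOneKing τ ∧ onPred Q (separators τ)

    isSeparatedKing-glue : ∀ {i p α β} → IsPerm i α → separators α ≡ 0 → IsPerm p β →
      isSeparatedKing (glue (i , α , β)) ≡ isIndecomposableKing α ∧ isTailKing β
    isSeparatedKing-glue {i} {p} {α} {β} αP α-free βP = begin
      isNonOneKing (glue (i , α , β)) ∧ onPred Q (separators (glue (i , α , β)))
        ≡⟨ cong₂ (λ a s → a ∧ onPred Q s) (isNonOneKing-glue αP α-free βP) (separators-glue β αP α-free) ⟩
      (isIndecomposableKing α ∧ isNonOneKing β) ∧ Q (separators β)
        ≡⟨ ∧-assoc (isIndecomposableKing α) _ _ ⟩
      isIndecomposableKing α ∧ isTailKing β ∎
      where open ≡-Reasoning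

    indecomposables : ℕ → List (List ℕ)
    indecomposables i = filter (λ x → T? (isIndecomposableKing x)) (perms i)

    tails : ℕ → List (List ℕ)
    tails zero = []
    tails (suc p) = filter (λ x → T? (isTailKing x)) (perms p)

    gluings-at : ℕ → ℕ → List (ℕ × List ℕ × List ℕ)
    gluings-at n i = map (i ,_) (cartesianProduct (indecomposables i) (tails (n ∸ i)))

    gluings : ℕ → List (ℕ × List ℕ × List ℕ)
    gluings n = concatMap (gluings-at n) (upTo (suc n))

    ∈-tails⁻ : ∀ q {β} → β ∈ tails q → ∃ λ p → q ≡ suc p × IsPerm p β × T (isTailKing β)
    ∈-tails⁻ (suc p) β∈ = let (β∈perms , βT) = ∈-filter⁻ (T? ∘ isTailKing) β∈ in p , refl , ∈-perms⁻ p β∈perms , βT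

    ∈-gluings⁺ : ∀ {n i α β} → i ≤ n → α ∈ indecomposables i → β ∈ tails (n ∸ i) → (i , α , β) ∈ gluings n
    ∈-gluings⁺ {n} {i} i≤n α∈ β∈ =
      ∈-concat⁺′ (∈-map⁺ (i ,_) (∈-cartesianProduct⁺ α∈ β∈)) (∈-map⁺ (gluings-at n) (∈-upTo⁺ (s≤s i≤n)))

    ∈-gluings⁻ : ∀ {n y} → y ∈ gluings n →
      ∃ λ i → ∃₂ λ α β → y ≡ (i , α , β) × α ∈ indecomposables i × β ∈ tails (n ∸ i)
    ∈-gluings⁻ {n} y∈ with ∈-concat⁻′ (map (gluings-at n) (upTo (suc n))) y∈
    ... | l , y∈l , l∈ with ∈-map⁻ (gluings-at n) {xs = upTo (suc n)} l∈
    ... | i , _ , refl with ∈-map⁻ (i ,_) y∈l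
    ... | (α , β) , αβ∈ , refl with ∈-cartesianProduct⁻ (indecomposables i) (tails (n ∸ i)) αβ∈
    ... | α∈ , β∈ = i , α , β , refl , α∈ , β∈

    tails-Unique : ∀ q → Unique (tails q)
    tails-Unique zero = []
    tails-Unique (suc p) = filter-Unique isTailKing (perms-Unique p)

    gluings-Unique : ∀ n → Unique (gluings n)
    gluings-Unique n = concatMap-Unique (gluings-at n) (upTo (suc n))
      (λ {i} _ → UP.map⁺ {f = i ,_} (λ { refl → refl })
                   (UP.cartesianProduct⁺ (filter-Unique isIndecomposableKing (perms-Unique i)) (tails-Unique (n ∸ i))))
      same-size (UP.upTo⁺ (suc n))
      where
      same-size : ∀ {i j y} → i ∈ upTo (suc n) → j ∈ upTo (suc n) → y ∈ gluings-at n i → y ∈ gluings-at n j → i ≡ j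
      same-size {i} {j} _ _ y∈i y∈j with ∈-map⁻ (i ,_) y∈i | ∈-map⁻ (j ,_) y∈j
      ... | _ , _ , refl | _ , _ , e = cong proj₁ e

    cut-separated : ∀ {n τ} → IsPerm n τ → T (isSeparatedKing τ) → cut τ ∈ gluings n × glue (cut τ) ≡ τ
    cut-separated {n} {τ} pτ t with firstSeparator [] τ in e
    ... | nothing = ⊥-elim (subst (T ∘ onPred Q) (firstSeparator-nothing [] τ e) (T-∧⁻ʳ {isNonOneKing τ} t))
    ... | just (α , r) with glue-split τ pτ e
    ... | p , β , τ≡ , αP , βP , size , α-free =
      subst (_∈ gluings n) (sym cut≡) (∈-gluings⁺ i≤n α∈ β∈) , trans (cong glue cut≡) (sym τ≡)
      where
      cut≡ : cutAt (just (α , r)) ≡ (length α , α , β)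
      cut≡ = trans (cong cutAt (sym e)) (trans (cong cut τ≡) (cut-glue β αP α-free))
      parts : T (isIndecomposableKing α ∧ isTailKing β)
      parts = subst T (trans (cong isSeparatedKing τ≡) (isSeparatedKing-glue αP α-free βP)) t
      i≤n : length α ≤ n
      i≤n = subst (length α ≤_) size (m≤m+n (length α) _)
      α∈ : α ∈ indecomposables (length α)
      α∈ = ∈-filter⁺ (T? ∘ isIndecomposableKing) (∈-perms⁺ _ αP) (T-∧⁻ˡ {isIndecomposableKing α} parts)
      β∈ : β ∈ tails (n ∸ length α)
      β∈ = subst (λ q → β ∈ tails q) (trans (sym (m+n∸m≡n (length α) (suc p))) (cong (_∸ length α) size))
             (∈-filter⁺ (T? ∘ isTailKing) (∈-perms⁺ p βP) (T-∧⁻ʳ {isIndecomposableKing α} parts))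

    glue-separated : ∀ {n y} → y ∈ gluings n → (IsPerm n (glue y) × T (isSeparatedKing (glue y))) × cut (glue y) ≡ y
    glue-separated {n} y∈ with ∈-gluings⁻ y∈
    ... | i , α , β , refl , α∈ , β∈ with ∈-filter⁻ (T? ∘ isIndecomposableKing) α∈ | ∈-tails⁻ (n ∸ i) β∈
    ... | α∈perms , αT | p , n∸i≡1+p , βP , βT =
      (subst (λ m → IsPerm m (glue (i , α , β))) size (IsPerm-glue αP βP) ,
       subst T (sym (isSeparatedKing-glue αP α-free βP)) (T-∧⁺ αT βT)) ,
      cut-glue β αP α-free
      where
      αP = ∈-perms⁻ i α∈perms
      α-free : separators α ≡ 0
      α-free = ≡ᵇ⇒≡ _ 0 (T-∧⁻ʳ (T-∧⁻ʳ {not (null α)} αT))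
      size : i + suc p ≡ n
      size = trans (cong (i +_) (sym n∸i≡1+p)) (m+[n∸m]≡n (<⇒≤ (m∸n≢0⇒n<m {n} {i} (λ n∸i≡0 → 1+n≢0 (trans (sym n∸i≡1+p) n∸i≡0)))))

    count-separated-kings : ∀ n → count isSeparatedKing (perms n) ≡ length (gluings n)
    count-separated-kings n = count-bijection isSeparatedKing n (gluings n) cut glue (gluings-Unique n)
      (λ p t → proj₁ (cut-separated p t)) (proj₁ ∘ glue-separated {n}) (λ p t → proj₂ (cut-separated p t)) (proj₂ ∘ glue-separated {n})

    count-separated-kings-sum : ∀ n → count isSeparatedKing (perms n) ≡
      sum (map (λ i → length (indecomposables i) * length (tails (n ∸ i))) (upTo (suc n)))
    count-separated-kings-sum n = begin
      count isSeparatedKing (perms n)                   ≡⟨ count-separated-kings n ⟩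
      length (concatMap (gluings-at n) (upTo (suc n)))  ≡⟨ length-concatMap (gluings-at n) (upTo (suc n)) ⟩
      sum (map (length ∘ gluings-at n) (upTo (suc n)))  ≡⟨ cong sum (map-cong size-at (upTo (suc n))) ⟩
      sum (map (λ i → length (indecomposables i) * length (tails (n ∸ i))) (upTo (suc n))) ∎
      where
      open ≡-Reasoning
      size-at : ∀ i → length (gluings-at n i) ≡ length (indecomposables i) * length (tails (n ∸ i))
      size-at i = trans (length-map (i ,_) (cartesianProduct (indecomposables i) (tails (n ∸ i)))) (length-cartesianProduct (indecomposables i) (tails (n ∸ i)))

  indecomposableKings : ℕ → ℕ
  indecomposableKings n = count isIndecomposableKing (perms n)

  separatorFree-nonOneKing : ∀ {m} σ → IsPerm (suc m) σ → isNonOneKing σ ∧ (separators σ ≡ᵇ 0) ≡ isIndecomposableKing σ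
  separatorFree-nonOneKing [] p with IsPerm⇒length p
  ... | ()
  separatorFree-nonOneKing (a ∷ σ) p with separators (a ∷ σ) ≡ᵇ 0 in free
  ... | false = trans (∧-zeroʳ _) (sym (∧-zeroʳ (isKing (a ∷ σ))))
  ... | true with a ≡ᵇ 1 in a≡ᵇ1
  ...   | false = cong (_∧ true) (∧-identityʳ (isKing (a ∷ σ)))
  ...   | true with ≡ᵇ⇒≡ a 1 (≡true⇒T a≡ᵇ1)
  ...     | refl = ⊥-elim (separators-1∷≢0 σ p (≡ᵇ⇒≡ _ 0 (≡true⇒T free)))

module Relations where

  open import Defs
  open BivariateSeries using (seriesRing; sumTo-cong)
  open SeriesCoefficients
  open Permutations
  open Separators
  open FirstLetter
  open FirstSeparator
  open import Data.Nat as ℕ using (ℕ; zero; suc; _∸_; _≡ᵇ_)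
  import Data.Nat.Properties as ℕ
  open import Data.Nat.ListAction using (sum)
  open import Data.Nat.ListAction.Properties using (sum-++)
  open import Data.Integer using (+_; _+_; _*_)
  import Data.Integer.Properties as ℤ
  open import Data.Bool using (Bool; true; not; _∧_)
  open import Data.Bool.Properties using (∧-identityʳ; ∧-zeroʳ)
  open import Data.List using (_++_; [_]; map; upTo; length)
  open import Data.List.Properties using (upTo-∷ʳ; map-++)
  open import Relation.Binary.PropositionalEquality using (_≡_; refl; sym; trans; cong; cong₂; module ≡-Reasoning)
  open CommutativeRing seriesRing using (_≈_)

  B X H : Series
  B = tSeries nonOneKings
  X = tSeries indecomposableKings
  H n k = + nonOneKingsWith n k

  sum-upTo : ∀ n (f : ℕ → ℕ) → + sum (map f (upTo (suc n))) ≡ sumTo n (λ i → + f i)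
  sum-upTo zero f = cong +_ (ℕ.+-identityʳ (f 0))
  sum-upTo (suc n) f = begin
    + sum (map f (upTo (suc (suc n))))                 ≡⟨ cong (λ l → + sum (map f l)) (upTo-∷ʳ (suc n)) ⟨
    + sum (map f (upTo (suc n) ++ [ suc n ]))  ≡⟨ cong (λ l → + sum l) (map-++ f (upTo (suc n)) _) ⟩
    + sum (map f (upTo (suc n)) ++ [ f (suc n) ]) ≡⟨ cong +_ (sum-++ (map f (upTo (suc n))) _) ⟩
    + (sum (map f (upTo (suc n))) ℕ.+ (f (suc n) ℕ.+ 0)) ≡⟨ ℤ.pos-+ (sum (map f (upTo (suc n)))) (f (suc n) ℕ.+ 0) ⟩
    + sum (map f (upTo (suc n))) + + (f (suc n) ℕ.+ 0)  ≡⟨ cong₂ _+_ (sum-upTo n f) (cong +_ (ℕ.+-identityʳ (f (suc n)))) ⟩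
    sumTo n (λ i → + f i) + + f (suc n)                ∎
    where open ≡-Reasoning

  𝟙-suc : ∀ n k → 𝟙 n (suc k) ≡ + 0
  𝟙-suc zero k = refl
  𝟙-suc (suc n) k = refl

  H-at-0 : ∀ n → H n 0 ≡ (𝟙 ⊕ X) n 0
  H-at-0 zero = refl
  H-at-0 (suc m) = cong +_ (count-perms-cong _ _ (suc m) (separatorFree-nonOneKing _))

  A-eq : A ≈ B ⊕ 𝕥 ⊗ B
  A-eq zero zero = refl
  A-eq (suc m) zero = begin
    + count isKing (perms (suc m))           ≡⟨ cong +_ (kings-by-first-letter m) ⟩
    + (nonOneKings (suc m) ℕ.+ nonOneKings m) ≡⟨ ℤ.pos-+ (nonOneKings (suc m)) _ ⟩
    B (suc m) 0 + B m 0                      ≡⟨ cong (λ c → B (suc m) 0 + c) (𝕥⊗-suc B m 0) ⟨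
    B (suc m) 0 + (𝕥 ⊗ B) (suc m) 0          ∎
    where open ≡-Reasoning
  A-eq zero (suc k) = sym (trans (ℤ.+-identityˡ _) (𝕥⊗-zero B (suc k)))
  A-eq (suc m) (suc k) = sym (trans (ℤ.+-identityˡ _) (𝕥⊗-suc B m (suc k)))

  kingsWith-count : ∀ n k → + count (isKingWith k) (perms n) ≡ + count (λ σ → isNonOneKing σ ∧ (0 ≡ᵇ k)) (perms n) + (𝕥 ⊗ H) n k
  kingsWith-count n k = begin
    + count (isKingWith k) (perms n)   ≡⟨ cong +_ (count-split (isKingWith k) startsWith1 (perms n)) ⟩
    + (with1 ℕ.+ without1)             ≡⟨ ℤ.pos-+ with1 without1 ⟩
    + with1 + + without1               ≡⟨ ℤ.+-comm (+ with1) (+ without1) ⟩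
    + without1 + + with1               ≡⟨ cong₂ _+_ (cong +_ (kingsWith-not-startsWith1 n k)) (starting-with-1 n k) ⟩
    + count (λ σ → isNonOneKing σ ∧ (0 ≡ᵇ k)) (perms n) + (𝕥 ⊗ H) n k ∎
    where
    open ≡-Reasoning
    with1 = count (λ σ → isKingWith k σ ∧ startsWith1 σ) (perms n)
    without1 = count (λ σ → isKingWith k σ ∧ not (startsWith1 σ)) (perms n)
    starting-with-1 : ∀ n k → + count (λ σ → isKingWith k σ ∧ startsWith1 σ) (perms n) ≡ (𝕥 ⊗ H) n k
    starting-with-1 zero zero = sym (𝕥⊗-zero H 0)
    starting-with-1 zero (suc k) = sym (𝕥⊗-zero H (suc k))
    starting-with-1 (suc m) k = trans (cong +_ (kingsWith-startsWith1 m k)) (sym (𝕥⊗-suc H m k))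

  E-eq : E ≈ B ⊕ 𝕥 ⊗ H
  E-eq n zero = trans (kingsWith-count n 0) (cong (λ c → + c + (𝕥 ⊗ H) n 0) (count-perms-cong _ _ n (λ _ → ∧-identityʳ _)))
  E-eq n (suc k) = trans (kingsWith-count n (suc k))
    (cong (λ c → + c + (𝕥 ⊗ H) n (suc k)) (trans (count-perms-cong _ _ n (λ _ → ∧-zeroʳ _)) (count-false (perms n))))

  P-eq : P ≈ B ⊕ 𝕥 ⊗ (𝟙 ⊕ X)
  P-eq n zero = trans (E-eq n 0) (cong (λ c → B n 0 + c) (𝕥H≡𝕥[1+X] n))
    where
    𝕥H≡𝕥[1+X] : ∀ n → (𝕥 ⊗ H) n 0 ≡ (𝕥 ⊗ (𝟙 ⊕ X)) n 0
    𝕥H≡𝕥[1+X] zero = trans (𝕥⊗-zero H 0) (sym (𝕥⊗-zero (𝟙 ⊕ X) 0))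
    𝕥H≡𝕥[1+X] (suc m) = trans (𝕥⊗-suc H m 0) (trans (H-at-0 m) (sym (𝕥⊗-suc (𝟙 ⊕ X) m 0)))
  P-eq zero (suc k) = sym (trans (ℤ.+-identityˡ _) (𝕥⊗-zero (𝟙 ⊕ X) (suc k)))
  P-eq (suc m) (suc k) = sym (trans (ℤ.+-identityˡ _) (trans (𝕥⊗-suc (𝟙 ⊕ X) m (suc k)) (cong (_+ + 0) (𝟙-suc m k))))

  X⊗-coefficient : ∀ f n k → (X ⊗ f) n k ≡ sumTo n (λ i → X i 0 * f (n ∸ i) k)
  X⊗-coefficient = tSeries⊗ indecomposableKings

  module _ (Q : ℕ → Bool) where
    open Gluing Q

    separated-coefficient : ∀ n k (G : Series) → (∀ q → + length (tails q) ≡ G q k) →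
      + count isSeparatedKing (perms n) ≡ (X ⊗ G) n k
    separated-coefficient n k G tails≡G = begin
      + count isSeparatedKing (perms n)
        ≡⟨ cong +_ (count-separated-kings-sum n) ⟩
      + sum (map (λ i → length (indecomposables i) ℕ.* length (tails (n ∸ i))) (upTo (suc n)))
        ≡⟨ sum-upTo n _ ⟩
      sumTo n (λ i → + (indecomposableKings i ℕ.* length (tails (n ∸ i))))
        ≡⟨ sumTo-cong n (λ i → trans (ℤ.pos-* (indecomposableKings i) _) (cong (X i 0 *_) (tails≡G (n ∸ i)))) ⟩
      sumTo n (λ i → X i 0 * G (n ∸ i) k)
        ≡⟨ X⊗-coefficient G n k ⟨
      (X ⊗ G) n k ∎
      where open ≡-Reasoning

  onPred-≡ᵇ : ∀ k s → (s ≡ᵇ suc k) ≡ onPred (_≡ᵇ k) s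
  onPred-≡ᵇ k zero = refl
  onPred-≡ᵇ k (suc s) = refl

  onPred-true : ∀ s → not (s ≡ᵇ 0) ≡ onPred (λ _ → true) s
  onPred-true zero = refl
  onPred-true (suc s) = refl

  H-eq : H ≈ 𝟙 ⊕ X ⊕ X ⊗ (𝕦 ⊗ (𝕥 ⊗ H))
  H-eq n zero = trans (H-at-0 n) (sym (trans (cong (λ c → (𝟙 ⊕ X) n 0 + c) no-u) (ℤ.+-identityʳ _)))
    where
    no-u : (X ⊗ (𝕦 ⊗ (𝕥 ⊗ H))) n 0 ≡ + 0
    no-u = trans (X⊗-coefficient (𝕦 ⊗ (𝕥 ⊗ H)) n 0)
             (sumTo-zero n _ (λ i → trans (cong (X i 0 *_) (𝕦⊗-zero (𝕥 ⊗ H) (n ∸ i))) (ℤ.*-zeroʳ (X i 0))))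
  H-eq n (suc k) = begin
    H n (suc k)
      ≡⟨ cong +_ (count-perms-cong _ _ n (λ {σ} _ → cong (isNonOneKing σ ∧_) (onPred-≡ᵇ k (separators σ)))) ⟩
    + count (Gluing.isSeparatedKing (_≡ᵇ k)) (perms n)
      ≡⟨ separated-coefficient (_≡ᵇ k) n (suc k) (𝕦 ⊗ (𝕥 ⊗ H)) tails≡ ⟩
    (X ⊗ (𝕦 ⊗ (𝕥 ⊗ H))) n (suc k)
      ≡⟨ ℤ.+-identityˡ _ ⟨
    + 0 + (X ⊗ (𝕦 ⊗ (𝕥 ⊗ H))) n (suc k)
      ≡⟨ cong (λ c → c + + 0 + (X ⊗ (𝕦 ⊗ (𝕥 ⊗ H))) n (suc k)) (𝟙-suc n k) ⟨
    (𝟙 ⊕ X ⊕ X ⊗ (𝕦 ⊗ (𝕥 ⊗ H))) n (suc k) ∎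
    where
    open ≡-Reasoning
    tails≡ : ∀ q → + length (Gluing.tails (_≡ᵇ k) q) ≡ (𝕦 ⊗ (𝕥 ⊗ H)) q (suc k)
    tails≡ zero = sym (trans (𝕦⊗-suc (𝕥 ⊗ H) 0 k) (𝕥⊗-zero H k))
    tails≡ (suc p) = sym (trans (𝕦⊗-suc (𝕥 ⊗ H) (suc p) k) (𝕥⊗-suc H p k))

  B-eq : B ≈ 𝟙 ⊕ X ⊕ X ⊗ (𝕥 ⊗ B)
  B-eq n zero = begin
    + nonOneKings n
      ≡⟨ cong +_ (count-split isNonOneKing (λ σ → separators σ ≡ᵇ 0) (perms n)) ⟩
    + (nonOneKingsWith n 0 ℕ.+ count (λ σ → isNonOneKing σ ∧ not (separators σ ≡ᵇ 0)) (perms n))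
      ≡⟨ ℤ.pos-+ (nonOneKingsWith n 0) _ ⟩
    H n 0 + + count (λ σ → isNonOneKing σ ∧ not (separators σ ≡ᵇ 0)) (perms n)
      ≡⟨ cong₂ _+_ (H-at-0 n) (cong +_ (count-perms-cong _ _ n (λ {σ} _ → cong (isNonOneKing σ ∧_) (onPred-true (separators σ))))) ⟩
    (𝟙 ⊕ X) n 0 + + count (Gluing.isSeparatedKing (λ _ → true)) (perms n)
      ≡⟨ cong (λ c → (𝟙 ⊕ X) n 0 + c) (separated-coefficient (λ _ → true) n 0 (𝕥 ⊗ B) tails≡) ⟩
    (𝟙 ⊕ X ⊕ X ⊗ (𝕥 ⊗ B)) n 0 ∎
    where
    open ≡-Reasoning
    tails≡ : ∀ q → + length (Gluing.tails (λ _ → true) q) ≡ (𝕥 ⊗ B) q 0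
    tails≡ zero = sym (𝕥⊗-zero B 0)
    tails≡ (suc p) = trans (cong +_ (count-perms-cong _ _ p (λ _ → ∧-identityʳ _))) (sym (𝕥⊗-suc B p 0))
  B-eq n (suc k) = sym (trans (cong₂ _+_ (cong (_+ + 0) (𝟙-suc n k)) no-u) refl)
    where
    no-u : (X ⊗ (𝕥 ⊗ B)) n (suc k) ≡ + 0
    no-u = trans (X⊗-coefficient (𝕥 ⊗ B) n (suc k))
             (sumTo-zero n _ (λ i → trans (cong (X i 0 *_) (u-free (n ∸ i))) (ℤ.*-zeroʳ (X i 0))))
      where
      u-free : ∀ q → (𝕥 ⊗ B) q (suc k) ≡ + 0
      u-free zero = 𝕥⊗-zero B (suc k)
      u-free (suc p) = 𝕥⊗-suc B p (suc k)

module InitialTerms where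

  open import Defs
  open SeriesCoefficients
  open Relations
  open import Data.Nat using (ℕ; zero; suc; _≤_; _<_; s≤s)
  open import Data.Integer using (ℤ; +_; _+_)
  open import Relation.Binary.PropositionalEquality using (_≡_; refl; trans; cong)

  by-0-1-rest : ∀ {f g : ℕ → ℤ} → f 0 ≡ g 0 → f 1 ≡ g 1 → (∀ k → f (suc (suc k)) ≡ g (suc (suc k))) → ∀ k → f k ≡ g k
  by-0-1-rest f0 _ _ zero = f0
  by-0-1-rest _ f1 _ (suc zero) = f1
  by-0-1-rest _ _ f2+ (suc (suc k)) = f2+ k

  -- Going through E-eq, only kings of length at most 7 are enumerated.
  initial : ∀ m → m < 8 → ∀ k → B (suc m) k + H m k ≡ initialE (suc m) k
  initial 0 _ = by-0-1-rest refl refl (λ _ → refl)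
  initial 1 _ = by-0-1-rest refl refl (λ _ → refl)
  initial 2 _ = by-0-1-rest refl refl (λ _ → refl)
  initial 3 _ = by-0-1-rest refl refl (λ _ → refl)
  initial 4 _ = by-0-1-rest refl refl (λ _ → refl)
  initial 5 _ = by-0-1-rest refl refl (λ _ → refl)
  initial 6 _ = by-0-1-rest refl refl (λ _ → refl)
  initial 7 _ = by-0-1-rest refl refl (λ _ → refl)
  initial (suc (suc (suc (suc (suc (suc (suc (suc m)))))))) (s≤s (s≤s (s≤s (s≤s (s≤s (s≤s (s≤s (s≤s ()))))))))

  E-initial : (n k : ℕ) → n ≤ 8 → E n k ≡ initialE n k
  E-initial zero zero _ = refl
  E-initial zero (suc k) _ = refl
  E-initial (suc m) k (s≤s m<8) = trans (E-eq (suc m) k) (trans (cong (λ c → B (suc m) k + c) (𝕥⊗-suc H m k)) (initial m (s≤s m<8) k))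

open import Defs
open import Data.Nat using (ℕ; _≤_)
open import Data.Product using (_×_; _,_)
open import Relation.Binary.PropositionalEquality using (_≡_)
open BivariateSeries using (seriesRing)
open SeriesCoefficients using (cancel-1-X𝕥)
open Relations using (B; X; H; A-eq; E-eq; P-eq; B-eq; H-eq)
open InitialTerms using (E-initial)

theorem4p2 : ((n k : ℕ) → (P ⊗ (𝟙 ⊕ 𝕥) ⊗ D₀) n k ≡ (A ⊗ (D₀ ⊕ 𝕥 ⊗ (𝟙 ⊕ 𝕥) ⊗ (𝟙 ⊕ 𝕥))) n k)
    × ((n k : ℕ) → (E ⊗ (𝟙 ⊕ 𝕥) ⊗ D) n k ≡ (A ⊗ (D ⊕ 𝕥 ⊗ (𝟙 ⊕ 𝕥) ⊗ (𝟙 ⊕ 𝕥))) n k)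
    × ((n k : ℕ) → n ≤ 8 → E n k ≡ initialE n k)
theorem4p2 =
    P-identity 𝕥 X B P A (cancel-1-X𝕥 X) B-eq P-eq A-eq
  , E-identity 𝕥 𝕦 X B H (cancel-1-X𝕥 X) B-eq H-eq E A E-eq A-eq
  , E-initial
  where open KingAlgebra seriesRing using (P-identity; E-identity)
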